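{- For every $n\geq 1$, the factoradic $n$-simplex $\Delta_n^!$ has local $h^\ast$-polynomial \[ \ell^\ast(\Delta_n^!;z)=\sum_{\substack{b\in\{1,\ldots,(n+1)!\}\\ b\equiv 1 \text{ or } 5 \pmod 6}} z^{\operatorname{des}(\pi^{(b)})}. \] In particular, for every $n\geq 2$, $\ell^\ast(\Delta_n^!;1)=\frac{(n+1)!}{3}$.
   Context: For a permutation $\pi=\pi_1\cdots\pi_m\in\mathfrak{S}_m$, $\operatorname{des}(\pi):=|\{i\in[m-1]:\pi_i>\pi_{i+1}\}|$, and $\operatorname{maxDes}(\pi):=\max\{i\in[m-1]:\pi_i>\pi_{i+1}\}$, with $\operatorname{maxDes}(\pi):=0$ if $\pi$ has no descents. Let $B_m(z):=\sum_{\pi\in\mathfrak{S}_m}z^{\operatorname{maxDes}(\pi)}$ and let $b_{m,k}$ be its coefficient of $z^k$. For $n\geq1$ let $q^{(n)}:=(b_{n+1,1},b_{n+1,2},\ldots,b_{n+1,n})$ and define the factoradic $n$-simplex $\Delta_n^!:=\Delta_{(1,q^{(n)})}$, where for a sequence of positive integers $q=(q_1,\ldots,q_n)$, $\Delta_{(1,q)}:=\operatorname{conv}(e^{(1)},\ldots,e^{(n)},-\sum_i q_ie^{(i)})\subset\mathbb{R}^n$ with $e^{(i)}$ the standard basis vectors. For a lattice $d$-simplex $\Delta=\operatorname{conv}(v^{(0)},\ldots,v^{(d)})\subset\mathbb{R}^n$, its local $h^\ast$-polynomial is $\ell^\ast(\Delta;z):=\sum_{x\in\Pi^\circ_\Delta\cap\mathbb{Z}^{n+1}}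 z^{x_{n+1}}$, where $\Pi^\circ_\Delta:=\{\sum_{i=0}^d\lambda_i(v^{(i)},1):0<\lambda_i<1\}$. Lehmer codes: for $\pi\in\mathfrak{S}_m$, its Lehmer code is $(\ell_{m-1},\ldots,\ell_1)$ with $\ell_i:=|\{0\leq j<i:\pi_{m-i}>\pi_{m-j}\}|$; this is a bijection from $\mathfrak{S}_m$ to $\{(\ell_{m-1},\ldots,\ell_1):\ell_k\in\{0,\ldots,k\}\}$. For $0\leq b<m!$, write uniquely $b=\sum_{k=1}^{m-1}\ell_k\,k!$ with $\ell_k\in\{0,\ldots,k\}$ (the factoradic representation), and let $\pi^{(b)}\in\mathfrak{S}_m$ be the permutation with Lehmer code $(\ell_{m-1},\ldots,\ell_1)$. In the claim $m=n+1$ (the value $b=(n+1)!$ never satisfies the congruence condition when relevant, so only $b<(n+1)!$ contribute). -}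

module Defs where

open import Data.Nat as ℕ using (ℕ; zero; suc; _+_; _*_; _∸_; _⊔_; _!; _/_; _%_; _<?_; _≤_)
open import Data.Nat.Properties using (_!≢0)
open import Data.Integer as ℤ using (ℤ; +_; -_)
open import Data.Rational as ℚ using (ℚ; 0ℚ; 1ℚ)
open import Data.Fin using (Fin; zero; suc; toℕ)
open import Data.Fin.Properties using () renaming (_≟_ to _≟ᶠ_)
open import Data.Vec as Vec using (Vec; lookup; tabulate; _∷ʳ_)
open import Data.List as List using (List; []; _∷_; length; filter; upTo; downFrom; foldr)
open import Data.List.Membership.Propositional using (_∈_)
open import Data.List.Relation.Unary.Unique.Propositional using (Unique)
open import Data.List.Relation.Binary.Permutation.Propositional using (_↭_)
open import Data.Product using (Σ; ∃-syntax; _×_; _,_)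
open import Data.Sum using (_⊎_)
open import Function.Bundles using (_⇔_)
open import Relation.Nullary.Decidable using (does)
open import Relation.Binary.PropositionalEquality using (_≡_)
open import Data.Bool using (if_then_else_)

HasCard : {A : Set} → (A → Set) → ℕ → Set
HasCard {A} P c =
  Σ (List A) λ xs → Unique xs × length xs ≡ c × (∀ x → P x ⇔ x ∈ xs)

-- Permutations of [m] = {1,…,m} as one-line words π₁⋯πₘ (lists of ℕ).

IsPerm : ℕ → List ℕ → Set
IsPerm m π = π ↭ List.map suc (upTo m)

-- 1-indexed descent positions i with πᵢ > πᵢ₊₁
descentsFrom : ℕ → List ℕ → List ℕ
descentsFrom i [] = []
descentsFrom i (x ∷ []) = []
descentsFrom i (x ∷ y ∷ xs) =
  if does (y <? x) then i ∷ descentsFrom (suc i) (y ∷ xs)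
                   else descentsFrom (suc i) (y ∷ xs)

descentSet : List ℕ → List ℕ
descentSet = descentsFrom 1

des : List ℕ → ℕ
des π = length (descentSet π)

-- maximum descent position, 0 if there is none
maxDes : List ℕ → ℕ
maxDes π = foldr _⊔_ 0 (descentSet π)

-- Lehmer code (ℓ_{m-1},…,ℓ₁) of π ∈ 𝔖ₘ, where ℓᵢ = #{0 ≤ j < i : π_{m-i} > π_{m-j}}
-- i.e. ℓᵢ = number of entries to the right of position m-i that are smaller.

smallerToRight : List ℕ → List ℕ
smallerToRight [] = []
smallerToRight (x ∷ xs) = length (filter (λ y → y <? x) xs) ∷ smallerToRight xs

-- positions 1..m-1 correspond to ℓ_{m-1},…,ℓ₁ (ℓ₀ = 0 is dropped)
lehmerCode : List ℕ → List ℕ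
lehmerCode π = List.take (length π ∸ 1) (smallerToRight π)

-- factoradic digits (ℓ_{m-1},…,ℓ₁) of b, where b = Σ_{k=1}^{m-1} ℓₖ k!, ℓₖ ∈ {0..k}
-- (for 0 ≤ b < m!): ℓₖ = ⌊b / k!⌋ mod (k+1).
factoradicDigit : ℕ → ℕ → ℕ
factoradicDigit b k = (_/_ b (k !) {{k !≢0}}) % suc k

factoradic : ℕ → ℕ → List ℕ
factoradic m b = List.map (factoradicDigit b) (List.map suc (downFrom (m ∸ 1)))

IsPermOfIndex : ℕ → ℕ → List ℕ → Set
IsPermOfIndex m b π = IsPerm m π × lehmerCode π ≡ factoradic m b

sumℚ : {k : ℕ} → (Fin k → ℚ) → ℚ
sumℚ {zero} f = 0ℚ
sumℚ {suc k} f = f zero ℚ.+ sumℚ (λ i → f (suc i))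

toℚ : ℤ → ℚ
toℚ z = z ℚ./ 1

liftPt : {N : ℕ} → Vec ℤ N → Vec ℤ (suc N)
liftPt v = v ∷ʳ + 1

-- x ∈ Π°_Δ for Δ = conv(V 0,…,V d) ⊂ ℝᴺ, x ∈ ℤᴺ⁺¹
InOpenPar : {d N : ℕ} → (Fin (suc d) → Vec ℤ N) → Vec ℤ (suc N) → Set
InOpenPar {d} {N} V x =
  Σ (Fin (suc d) → ℚ) λ lam → ((∀ i → (0ℚ ℚ.< lam i) × (lam i ℚ.< 1ℚ)) ×
          (∀ j → toℚ (lookup x j) ≡ sumℚ (λ i → lam i ℚ.* toℚ (lookup (liftPt (V i)) j))))

-- c is the coefficient of z^k in ℓ*(Δ;z)
LocalHStarCoeff : {d N : ℕ} → (Fin (suc d) → Vec ℤ N) → ℕ → ℕ → Set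
LocalHStarCoeff V k c = HasCard (λ x → InOpenPar V x × Vec.last x ≡ + k) c

-- c = ℓ*(Δ;1)
LocalHStarAtOne : {d N : ℕ} → (Fin (suc d) → Vec ℤ N) → ℕ → Set
LocalHStarAtOne V c = HasCard (InOpenPar V) c

-- Vertices of Δ_(1,q) ⊂ ℝⁿ: vertex 0 is -Σ qᵢ e⁽ⁱ⁾, vertex (suc j) is e⁽ʲ⁺¹⁾.
-- q is given as a function ℕ → ℕ; only q 1,…,q n are used (qᵢ = q i).
simplex1q : (n : ℕ) → (ℕ → ℕ) → Fin (suc n) → Vec ℤ n
simplex1q n q zero = tabulate (λ i → - (+ q (suc (toℕ i))))
simplex1q n q (suc j) = tabulate (λ i → if does (i ≟ᶠ j) then + 1 else + 0)

IsMaxDesCounts : ℕ → (ℕ → ℕ) → Set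
IsMaxDesCounts m q = ∀ k → HasCard (λ π → IsPerm m π × maxDes π ≡ k) (q k)

RHSCoeff : ℕ → ℕ → ℕ → Set
RHSCoeff m k c =
  HasCard (λ b → (1 ≤ b × b ≤ m !) × (b % 6 ≡ 1 ⊎ b % 6 ≡ 5) ×
                 ∃[ π ] (IsPermOfIndex m b π × des π ≡ k)) c

-- Δ_(1,q) has normalised volume F = 1 + q₁ + ⋯ + qₙ, and the lattice points of its open
-- fundamental parallelepiped are those with barycentric coordinates λ₀ = t/F and
-- λ_c = (t q_c mod F)/F, for the 0 < t < F with t q_c ≢ 0 (mod F) for all c; such a point has
-- height (t + Σ_c (t q_c mod F))/F.  For q_k = b_{m,k}, m = n + 1, reading permutations through
-- their Lehmer codes gives b_{m,m−j} = m!/j! − m!/(j+1)!, so F = m! and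
-- t q_{m−j} ≡ A_j − A_{j+1} (mod m!) with A_j = t·m!/j! mod m!.  Consecutive A_j compare like
-- consecutive factoradic digits of t, so the height telescopes to the number of descents of
-- π^(t); and A_j = A_{j+1} for some j exactly when t ≢ 1, 5 (mod 6).

module Submission where

open import Defs
open import Data.Bool using (Bool; T; true; false; if_then_else_)
open import Data.Empty using (⊥; ⊥-elim)
open import Data.Fin as Fin using (Fin; toℕ; inject₁; fromℕ)
import Data.Fin.Properties as FinP
open import Data.Integer as ℤ using (ℤ; +<+; +≤+)
import Data.Integer.Properties as ℤP
import Data.Integer.Solver as ℤS
open import Data.List as List using (List; []; _∷_; _++_; length; filter; upTo; downFrom; foldr; map)
open import Data.List.Membership.Propositional using (_∈_)
open import Data.List.Membership.Propositional.Properties using (∈-map⁺; ∈-map⁻; ∈-upTo⁺; ∈-upTo⁻; ∈-filter⁺; ∈-filter⁻)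
open import Data.List.Membership.Propositional.Properties.WithK using (unique∧set⇒bag)
open import Data.List.Properties using (length-map; length-upTo; length-downFrom; length-filter; length-++; filter-accept; filter-reject; filter-++; upTo-∷ʳ; downFrom-∷ʳ; map-downFrom; map-++; ++-cancelʳ; ∷-injectiveˡ; ∷-injectiveʳ)
open import Data.List.Relation.Binary.BagAndSetEquality using (∼bag⇒↭)
open import Data.List.Relation.Binary.Permutation.Propositional using (_↭_; ↭-sym; ↭⇒↭ₛ)
open import Data.List.Relation.Binary.Permutation.Propositional.Properties using (filter-↭; ↭-length; ∈-resp-↭)
open import Data.List.Relation.Binary.Permutation.Setoid.Properties using (Unique-resp-↭)
open import Data.List.Relation.Unary.All using (All; []; _∷_)
open import Data.List.Relation.Unary.All.Properties using (All¬⇒¬Any)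
open import Data.List.Relation.Unary.AllPairs using ([]; _∷_)
open import Data.List.Relation.Unary.Any using (here; there)
open import Data.List.Relation.Unary.Unique.Propositional using (Unique)
import Data.List.Relation.Unary.Unique.Propositional.Properties as Unique
open import Data.Nat using (ℕ; zero; suc; _+_; _*_; _∸_; _⊔_; _!; _/_; _%_; _<?_; _≤?_; _≟_; _≤_; _<_; z≤n; s≤s; NonZero; ≢-nonZero⁻¹; >-nonZero; >-nonZero⁻¹; _<ᵇ_)
open import Data.Nat.DivMod
open import Data.Nat.Divisibility using (∣-refl; m≤n⇒m!∣n!; n∣m*n; ∣n⇒∣m*n; n∣m⇒m%n≡0; divides)
import Data.Nat.GCD as ℕGCD
open import Data.Nat.Properties
open import Data.Nat.Solver using (module +-*-Solver)
open import Data.Product using (Σ; ∃-syntax; _×_; _,_; proj₁; proj₂; map₁)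
open import Data.Rational as ℚ using (ℚ; 0ℚ; 1ℚ; ↥_; ↧_; *<*)
import Data.Rational.Properties as ℚP
import Data.Rational.Solver as ℚS
import Data.Rational.Unnormalised as ℚᵘ
import Data.Rational.Unnormalised.Properties as ℚᵘP
open import Data.Sum using (_⊎_; inj₁; inj₂; [_,_]′)
open import Data.Unit using (⊤; tt)
open import Data.Vec as Vec using (Vec; lookup; tabulate; _∷ʳ_)
open import Data.Vec.Properties using (lookup∘tabulate; tabulate∘lookup; tabulate-cong; last-∷ʳ)
open import Function using (id; _∘_)
open import Function.Bundles using (_⇔_; mk⇔; Equivalence)
open import Function.Construct.Composition using (_⇔-∘_)
import Function.Related.Propositional as Related
open import Relation.Binary.Definitions using (tri<; tri≈; tri>)
open import Relation.Binary.PropositionalEquality using (_≡_; _≢_; refl; sym; trans; cong; cong₂; subst; subst₂; setoid; module ≡-Reasoning)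
open import Relation.Nullary using (¬_; Dec; yes; no; contradiction)
open import Relation.Nullary.Decidable using (does; dec-true; dec-false; _×-dec_; _⊎-dec_; ¬?)
open import Relation.Unary using (Decidable)

open Equivalence using (to; from)

-- Lehmer codes

countBelow : ℕ → List ℕ → ℕ
countBelow x xs = length (filter (_<? x) xs)

countBelow-∷-< : ∀ {x y} ys → y < x → countBelow x (y ∷ ys) ≡ suc (countBelow x ys)
countBelow-∷-< {x} ys y<x = cong length (filter-accept (_<? x) y<x)

countBelow-∷-≮ : ∀ {x y} ys → ¬ y < x → countBelow x (y ∷ ys) ≡ countBelow x ys
countBelow-∷-≮ {x} ys y≮x = cong length (filter-reject (_<? x) y≮x)

countBelow-mono-≤ : ∀ {x x′} ys → x ≤ x′ → countBelow x ys ≤ countBelow x′ ys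
countBelow-mono-≤ [] x≤x′ = z≤n
countBelow-mono-≤ {x} {x′} (y ∷ ys) x≤x′ with y <? x | y <? x′
... | yes y<x | yes y<x′ rewrite countBelow-∷-< ys y<x | countBelow-∷-< ys y<x′ = s≤s (countBelow-mono-≤ ys x≤x′)
... | yes y<x | no y≮x′ = contradiction (<-≤-trans y<x x≤x′) y≮x′
... | no y≮x | yes y<x′ rewrite countBelow-∷-≮ ys y≮x | countBelow-∷-< ys y<x′ = m≤n⇒m≤1+n (countBelow-mono-≤ ys x≤x′)
... | no y≮x | no y≮x′ rewrite countBelow-∷-≮ ys y≮x | countBelow-∷-≮ ys y≮x′ = countBelow-mono-≤ ys x≤x′

countBelow-mono-<-∈ : ∀ {x x′} ys → x ∈ ys → x < x′ → countBelow x ys < countBelow x′ ys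
countBelow-mono-<-∈ {x} {x′} (y ∷ ys) (here refl) x<x′
  rewrite countBelow-∷-≮ {x} ys (<-irrefl refl) | countBelow-∷-< {x′} ys x<x′ =
  s≤s (countBelow-mono-≤ ys (<⇒≤ x<x′))
countBelow-mono-<-∈ {x} {x′} (y ∷ ys) (there x∈ys) x<x′ with y <? x | y <? x′
... | yes y<x | yes y<x′ rewrite countBelow-∷-< ys y<x | countBelow-∷-< ys y<x′ = s≤s (countBelow-mono-<-∈ ys x∈ys x<x′)
... | yes y<x | no y≮x′ = contradiction (<-trans y<x x<x′) y≮x′
... | no y≮x | yes y<x′ rewrite countBelow-∷-≮ ys y≮x | countBelow-∷-< ys y<x′ = m<n⇒m<1+n (countBelow-mono-<-∈ ys x∈ys x<x′)
... | no y≮x | no y≮x′ rewrite countBelow-∷-≮ ys y≮x | countBelow-∷-≮ ys y≮x′ = countBelow-mono-<-∈ ys x∈ys x<x′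

countBelow≤length : ∀ x ys → countBelow x ys ≤ length ys
countBelow≤length x ys = length-filter (_<? x) ys

countBelow-resp-↭ : ∀ x {ys zs} → ys ↭ zs → countBelow x ys ≡ countBelow x zs
countBelow-resp-↭ x p = ↭-length (filter-↭ (_<? x) p)

countBelow-map : ∀ (f : ℕ → ℕ) {a b} → (∀ {y} → f y < a ⇔ y < b) → ∀ ys → countBelow a (map f ys) ≡ countBelow b ys
countBelow-map f h [] = refl
countBelow-map f {a} {b} h (y ∷ ys) = step (y <? b)
  where
  step : Dec (y < b) → countBelow a (map f (y ∷ ys)) ≡ countBelow b (y ∷ ys)
  step (yes y<b) = trans (countBelow-∷-< (map f ys) (from h y<b)) (trans (cong suc (countBelow-map f h ys)) (sym (countBelow-∷-< ys y<b)))
  step (no y≮b) = trans (countBelow-∷-≮ (map f ys) (λ p → y≮b (to h p))) (trans (countBelow-map f h ys) (sym (countBelow-∷-≮ ys y≮b)))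

smallerToRight-map : ∀ (f : ℕ → ℕ) → (∀ {y z} → f y < f z ⇔ y < z) → ∀ ys → smallerToRight (map f ys) ≡ smallerToRight ys
smallerToRight-map f h [] = refl
smallerToRight-map f h (y ∷ ys) = cong₂ _∷_ (countBelow-map f h ys) (smallerToRight-map f h ys)

length-smallerToRight : ∀ ys → length (smallerToRight ys) ≡ length ys
length-smallerToRight [] = refl
length-smallerToRight (y ∷ ys) = cong suc (length-smallerToRight ys)

descentsFrom-> : ∀ i {a b} r → b < a → descentsFrom i (a ∷ b ∷ r) ≡ i ∷ descentsFrom (suc i) (b ∷ r)
descentsFrom-> i {a} {b} r b<a with b <ᵇ a in eq
... | true = refl
... | false = ⊥-elim (subst T eq (<⇒<ᵇ b<a))

descentsFrom-≯ : ∀ i {a b} r → ¬ b < a → descentsFrom i (a ∷ b ∷ r) ≡ descentsFrom (suc i) (b ∷ r)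
descentsFrom-≯ i {a} {b} r b≮a with b <ᵇ a in eq
... | true = contradiction (<ᵇ⇒< b a (subst T (sym eq) tt)) b≮a
... | false = refl

descentsFrom-smallerToRight : ∀ i xs → Unique xs → descentsFrom i (smallerToRight xs) ≡ descentsFrom i xs
descentsFrom-smallerToRight i [] _ = refl
descentsFrom-smallerToRight i (x ∷ []) _ = refl
descentsFrom-smallerToRight i (x ∷ y ∷ r) ((x≢y ∷ _) ∷ u) with <-cmp y x
... | tri< y<x _ _ = begin
  descentsFrom i (countBelow x (y ∷ r) ∷ countBelow y r ∷ smallerToRight r)
    ≡⟨ descentsFrom-> i (smallerToRight r) (subst (countBelow y r <_) (sym (countBelow-∷-< r y<x)) (s≤s (countBelow-mono-≤ r (<⇒≤ y<x)))) ⟩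
  i ∷ descentsFrom (suc i) (smallerToRight (y ∷ r))
    ≡⟨ cong (i ∷_) (descentsFrom-smallerToRight (suc i) (y ∷ r) u) ⟩
  i ∷ descentsFrom (suc i) (y ∷ r)
    ≡⟨ descentsFrom-> i r y<x ⟨
  descentsFrom i (x ∷ y ∷ r) ∎
  where open ≡-Reasoning
... | tri≈ _ y≡x _ = contradiction (sym y≡x) x≢y
... | tri> y≮x _ x<y = begin
  descentsFrom i (countBelow x (y ∷ r) ∷ countBelow y r ∷ smallerToRight r)
    ≡⟨ descentsFrom-≯ i (smallerToRight r) (λ c → ≤⇒≯ (countBelow-mono-≤ r (<⇒≤ x<y)) (subst (countBelow y r <_) (countBelow-∷-≮ r y≮x) c)) ⟩
  descentsFrom (suc i) (smallerToRight (y ∷ r))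
    ≡⟨ descentsFrom-smallerToRight (suc i) (y ∷ r) u ⟩
  descentsFrom (suc i) (y ∷ r)
    ≡⟨ descentsFrom-≯ i r y≮x ⟨
  descentsFrom i (x ∷ y ∷ r) ∎
  where open ≡-Reasoning

oneTo : ℕ → List ℕ
oneTo m = map suc (upTo m)

∈-oneTo⁺ : ∀ {m x} → 1 ≤ x → x ≤ m → x ∈ oneTo m
∈-oneTo⁺ {x = suc x} _ x≤m = ∈-map⁺ suc (∈-upTo⁺ x≤m)

∈-oneTo⁻ : ∀ {m x} → x ∈ oneTo m → 1 ≤ x × x ≤ m
∈-oneTo⁻ p with ∈-map⁻ suc p
... | y , y∈ , refl = s≤s z≤n , ∈-upTo⁻ y∈

Unique-oneTo : ∀ m → Unique (oneTo m)
Unique-oneTo m = Unique.map⁺ suc-injective (Unique.upTo⁺ m)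

IsPermSet : ℕ → List ℕ → Set
IsPermSet m π = Unique π × (∀ x → x ∈ π ⇔ (1 ≤ x × x ≤ m))

Unique∧sameElements⇒↭ : ∀ {A : Set} {xs ys : List A} → Unique xs → Unique ys → (∀ x → x ∈ xs ⇔ x ∈ ys) → xs ↭ ys
Unique∧sameElements⇒↭ ux uy eq = ∼bag⇒↭ (unique∧set⇒bag ux uy (λ {x} → eq x))

isPerm⇔isPermSet : ∀ {m π} → IsPerm m π ⇔ IsPermSet m π
isPerm⇔isPermSet {m} = mk⇔
  (λ p → Unique-resp-↭ (setoid ℕ) (↭⇒↭ₛ (↭-sym p)) (Unique-oneTo m) ,
         λ x → mk⇔ (λ x∈ → ∈-oneTo⁻ (∈-resp-↭ p x∈)) (λ (1≤x , x≤m) → ∈-resp-↭ (↭-sym p) (∈-oneTo⁺ 1≤x x≤m)))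
  (λ (u , e) → Unique∧sameElements⇒↭ u (Unique-oneTo m)
         (λ x → mk⇔ (λ x∈ → ∈-oneTo⁺ (proj₁ (to (e x) x∈)) (proj₂ (to (e x) x∈))) (λ x∈ → from (e x) (∈-oneTo⁻ x∈))))

length-perm : ∀ {m π} → IsPerm m π → length π ≡ m
length-perm {m} p = trans (↭-length p) (trans (length-map suc (upTo m)) (length-upTo m))

hasCard-unique : {A : Set} {P : A → Set} {c c′ : ℕ} → HasCard P c → HasCard P c′ → c ≡ c′
hasCard-unique (xs , ux , refl , ex) (ys , uy , refl , ey) =
  ↭-length (Unique∧sameElements⇒↭ ux uy (λ x → mk⇔ (λ p → to (ey x) (from (ex x) p)) (λ p → to (ex x) (from (ey x) p))))

-- The first entries agree because each is determined by its rank among the common entries.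
smallerToRight-injective : ∀ xs ys → Unique xs → Unique ys → (∀ x → x ∈ xs ⇔ x ∈ ys) →
  smallerToRight xs ≡ smallerToRight ys → xs ≡ ys
smallerToRight-injective [] [] _ _ _ _ = refl
smallerToRight-injective [] (y ∷ ys) _ _ e _ with from (e y) (here refl)
... | ()
smallerToRight-injective (x ∷ xs) [] _ _ e _ with to (e x) (here refl)
... | ()
smallerToRight-injective (x ∷ xs) (y ∷ ys) ux@(x∉ ∷ uxs) uy@(y∉ ∷ uys) e eq =
  cong₂ _∷_ x≡y (smallerToRight-injective xs ys uxs uys tails (∷-injectiveʳ eq))
  where
  sameCounts : ∀ z → countBelow z (x ∷ xs) ≡ countBelow z (y ∷ ys)
  sameCounts z = countBelow-resp-↭ z (Unique∧sameElements⇒↭ ux uy e)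
  rankClash : ∀ a b as bs → (∀ z → countBelow z (a ∷ as) ≡ countBelow z (b ∷ bs)) →
    countBelow a as ≡ countBelow b bs → a ∈ b ∷ bs → ¬ a < b
  rankClash a b as bs counts head≡ a∈ a<b = <-irrefl refl (begin-strict
    countBelow b bs        ≡⟨ head≡ ⟨
    countBelow a as        ≡⟨ countBelow-∷-≮ as (<-irrefl refl) ⟨
    countBelow a (a ∷ as)  ≡⟨ counts a ⟩
    countBelow a (b ∷ bs)  ≡⟨ countBelow-∷-≮ bs (<⇒≯ a<b) ⟩
    countBelow a bs        <⟨ countBelow-mono-<-∈ bs (a∈bs a∈) a<b ⟩
    countBelow b bs        ∎)
    where
    open ≤-Reasoning
    a∈bs : a ∈ b ∷ bs → a ∈ bs
    a∈bs (here a≡b) = contradiction a≡b (<⇒≢ a<b)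
    a∈bs (there a∈) = a∈
  x≡y : x ≡ y
  x≡y with <-cmp x y
  ... | tri< x<y _ _ = ⊥-elim (rankClash x y xs ys sameCounts (∷-injectiveˡ eq) (to (e x) (here refl)) x<y)
  ... | tri≈ _ x≡y _ = x≡y
  ... | tri> _ _ y<x = ⊥-elim (rankClash y x ys xs (λ z → sym (sameCounts z)) (sym (∷-injectiveˡ eq)) (from (e y) (here refl)) y<x)
  tails : ∀ z → z ∈ xs ⇔ z ∈ ys
  tails z = mk⇔ f g
    where
    f : z ∈ xs → z ∈ ys
    f z∈ with to (e z) (there z∈)
    ... | here refl = ⊥-elim (All¬⇒¬Any x∉ (subst (_∈ xs) (sym x≡y) z∈))
    ... | there z∈ys = z∈ys
    g : z ∈ ys → z ∈ xs
    g z∈ with from (e z) (there z∈)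
    ... | here refl = ⊥-elim (All¬⇒¬Any y∉ (subst (_∈ ys) x≡y z∈))
    ... | there z∈xs = z∈xs

IsCode : List ℕ → Set
IsCode [] = ⊤
IsCode (d ∷ ds) = d ≤ length ds × IsCode ds

isCode-smallerToRight : ∀ xs → IsCode (smallerToRight xs)
isCode-smallerToRight [] = tt
isCode-smallerToRight (x ∷ xs) =
  subst (countBelow x xs ≤_) (sym (length-smallerToRight xs)) (countBelow≤length x xs) , isCode-smallerToRight xs

punchIn : ℕ → ℕ → ℕ
punchIn d y with y ≤? d
... | yes _ = y
... | no _ = suc y

punchIn-≤ : ∀ {d y} → y ≤ d → punchIn d y ≡ y
punchIn-≤ {d} {y} y≤d with y ≤? d
... | yes _ = refl
... | no y≰d = contradiction y≤d y≰d

punchIn-> : ∀ {d y} → ¬ y ≤ d → punchIn d y ≡ suc y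
punchIn-> {d} {y} y≰d with y ≤? d
... | yes y≤d = contradiction y≤d y≰d
... | no _ = refl

punchIn-mono-< : ∀ d {y z} → y < z → punchIn d y < punchIn d z
punchIn-mono-< d {y} {z} y<z with y ≤? d | z ≤? d
... | yes _ | yes _ = y<z
... | yes _ | no _ = m<n⇒m<1+n y<z
... | no y≰d | yes z≤d = contradiction (≤-trans (<⇒≤ y<z) z≤d) y≰d
... | no _ | no _ = s≤s y<z

punchIn-cancel-< : ∀ d {y z} → punchIn d y < punchIn d z → y < z
punchIn-cancel-< d {y} {z} lt with <-cmp y z
... | tri< y<z _ _ = y<z
... | tri≈ _ refl _ = contradiction lt (<-irrefl refl)
... | tri> _ _ z<y = contradiction (punchIn-mono-< d z<y) (<⇒≯ lt)

punchIn-injective : ∀ d {y z} → punchIn d y ≡ punchIn d z → y ≡ z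
punchIn-injective d {y} {z} eq with <-cmp y z
... | tri< y<z _ _ = contradiction eq (<⇒≢ (punchIn-mono-< d y<z))
... | tri≈ _ y≡z _ = y≡z
... | tri> _ _ z<y = contradiction (sym eq) (<⇒≢ (punchIn-mono-< d z<y))

punchIn≢suc : ∀ d y → suc d ≢ punchIn d y
punchIn≢suc d y eq with y ≤? d
... | yes y≤d = <-irrefl (sym eq) (s≤s y≤d)
... | no y≰d = y≰d (≤-reflexive (sym (suc-injective eq)))

-- Read off from the left: the first entry of π ∈ 𝔖ᵢ₊₁ is one more than its code entry d,
-- and the remaining entries are a permutation of [i] with the values above d shifted up.
fromCode : List ℕ → List ℕ
fromCode [] = []
fromCode (d ∷ ds) = suc d ∷ map (punchIn d) (fromCode ds)

countBelow-permSet : ∀ {i d τ} → IsPermSet i τ → d ≤ i → countBelow (suc d) τ ≡ d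
countBelow-permSet {i} {d} {τ} (u , e) d≤i =
  hasCard-unique below (oneTo d , Unique-oneTo d , trans (length-map suc (upTo d)) (length-upTo d) ,
                         λ x → mk⇔ (λ (1≤x , x≤d) → ∈-oneTo⁺ 1≤x x≤d) ∈-oneTo⁻)
  where
  below : HasCard (λ x → 1 ≤ x × x ≤ d) (countBelow (suc d) τ)
  below = filter (_<? suc d) τ , Unique.filter⁺ (_<? suc d) u , refl ,
    λ x → mk⇔ (λ (1≤x , x≤d) → ∈-filter⁺ (_<? suc d) (from (e x) (1≤x , ≤-trans x≤d d≤i)) (s≤s x≤d))
              (λ x∈ → proj₁ (to (e x) (proj₁ (∈-filter⁻ (_<? suc d) {xs = τ} x∈))) , ≤-pred (proj₂ (∈-filter⁻ (_<? suc d) {xs = τ} x∈)))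

isPermSet-fromCode : ∀ ds → IsCode ds → IsPermSet (length ds) (fromCode ds)
isPermSet-fromCode [] _ = [] , λ x → mk⇔ (λ ()) (λ { (s≤s _ , ()) })
isPermSet-fromCode (d ∷ ds) (d≤ , c) = (notHead (fromCode ds) ∷ Unique.map⁺ (punchIn-injective d) u) , members
  where
  u = proj₁ (isPermSet-fromCode ds c)
  e = proj₂ (isPermSet-fromCode ds c)
  notHead : ∀ ys → All (suc d ≢_) (map (punchIn d) ys)
  notHead [] = []
  notHead (y ∷ ys) = punchIn≢suc d y ∷ notHead ys
  members : ∀ x → x ∈ fromCode (d ∷ ds) ⇔ (1 ≤ x × x ≤ suc (length ds))
  members x = mk⇔ f g
    where
    f : x ∈ fromCode (d ∷ ds) → 1 ≤ x × x ≤ suc (length ds)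
    f (here refl) = s≤s z≤n , s≤s d≤
    f (there x∈) with ∈-map⁻ (punchIn d) x∈
    ... | y , y∈ , refl with to (e y) y∈ | y ≤? d
    ...   | 1≤y , y≤ | yes y≤d = 1≤y , m≤n⇒m≤1+n y≤
    ...   | 1≤y , y≤ | no y≰d = s≤s z≤n , s≤s y≤
    g : 1 ≤ x × x ≤ suc (length ds) → x ∈ fromCode (d ∷ ds)
    g (1≤x , x≤) with <-cmp x (suc d)
    ... | tri≈ _ refl _ = here refl
    ... | tri< x<sd _ _ = there (subst (_∈ map (punchIn d) (fromCode ds)) (punchIn-≤ (≤-pred x<sd))
                                 (∈-map⁺ (punchIn d) (from (e x) (1≤x , ≤-trans (≤-pred x<sd) d≤))))
    g (_ , s≤s x≤) | tri> _ _ (s≤s d<x′) = there (subst (_∈ map (punchIn d) (fromCode ds)) (punchIn-> (<⇒≱ d<x′))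
                                 (∈-map⁺ (punchIn d) (from (e _) (≤-trans (s≤s z≤n) d<x′ , x≤))))

smallerToRight-fromCode : ∀ ds → IsCode ds → smallerToRight (fromCode ds) ≡ ds
smallerToRight-fromCode [] _ = refl
smallerToRight-fromCode (d ∷ ds) (d≤ , c) = cong₂ _∷_ head (trans (smallerToRight-map (punchIn d) (mk⇔ (punchIn-cancel-< d) (punchIn-mono-< d)) (fromCode ds)) (smallerToRight-fromCode ds c))
  where
  preservesBelow : ∀ {y} → punchIn d y < suc d ⇔ y < suc d
  preservesBelow {y} with y ≤? d
  ... | yes y≤d = mk⇔ (λ _ → s≤s y≤d) (λ _ → s≤s y≤d)
  ... | no y≰d = mk⇔ (λ lt → contradiction (<⇒≤ (≤-pred lt)) y≰d) (λ lt → contradiction (≤-pred lt) y≰d)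
  head : countBelow (suc d) (map (punchIn d) (fromCode ds)) ≡ d
  head = trans (countBelow-map (punchIn d) preservesBelow (fromCode ds)) (countBelow-permSet (isPermSet-fromCode ds c) d≤)

-- Factoradic digits and residues modulo factorials

infixl 7 _%!_

_%!_ : ℕ → ℕ → ℕ
t %! j = (t % j !) {{j !≢0}}

digit : ℕ → ℕ → ℕ
digit = factoradicDigit

digit≤ : ∀ t j → digit t j ≤ j
digit≤ t j = ≤-pred (m%n<n ((t / j !) {{j !≢0}}) (suc j))

digit-zero : ∀ t → digit t 0 ≡ 0
digit-zero t = n≤0⇒n≡0 (digit≤ t 0)

%!<! : ∀ t j → t %! j < j !
%!<! t j = m%n<n t (j !) {{j !≢0}}

%!-zero : ∀ t → t %! 0 ≡ 0
%!-zero t = n%1≡0 t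

%!-one : ∀ t → t %! 1 ≡ 0
%!-one t = n%1≡0 t

%!-of-< : ∀ {t} j → t < j ! → t %! j ≡ t
%!-of-< j = m<n⇒m%n≡m {{j !≢0}}

digit≡%!/ : ∀ t j → digit t j ≡ (t %! suc j / j !) {{j !≢0}}
digit≡%!/ t j = sym (m%[n*o]/o≡m/o%n t (suc j) (j !) {{_}} {{j !≢0}} {{suc j !≢0}})

%!-suc : ∀ t j → t %! suc j ≡ digit t j * j ! + t %! j
%!-suc t j = begin
  x                        ≡⟨ m≡m%n+[m/n]*n x (j !) ⟩
  x % j ! + x / j ! * j !  ≡⟨ +-comm (x % j !) _ ⟩
  x / j ! * j ! + x % j !  ≡⟨ cong₂ (λ a b → a * j ! + b) (sym (digit≡%!/ t j)) (m∣n⇒o%n%m≡o%m (j !) (suc j !) t (m≤n⇒m!∣n! (n≤1+n j))) ⟩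
  digit t j * j ! + t %! j ∎
  where
  open ≡-Reasoning
  instance
    _ = j !≢0
    _ = suc j !≢0
  x = t %! suc j

%!-two : ∀ t → t %! 2 ≡ digit t 1
%!-two t = trans (%!-suc t 1) (trans (cong (digit t 1 * 1 +_) (%!-one t)) (trans (+-identityʳ _) (*-identityʳ _)))

%!≡0-antimono : ∀ t {i j} → i ≤ j → t %! j ≡ 0 → t %! i ≡ 0
%!≡0-antimono t {i} {j} i≤j t%!j≡0 = begin
  t %! i             ≡⟨ m∣n⇒o%n%m≡o%m (i !) (j !) t (m≤n⇒m!∣n! i≤j) ⟨
  t %! j % i !       ≡⟨ cong (_% i !) t%!j≡0 ⟩
  0 % i !            ≡⟨ m*n%n≡0 0 (i !) ⟩
  0                  ∎
  where
  open ≡-Reasoning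
  instance
    _ = i !≢0
    _ = j !≢0

%!-suc≡0⇔ : ∀ t j → t %! suc j ≡ 0 ⇔ (digit t j ≡ 0 × t %! j ≡ 0)
%!-suc≡0⇔ t j = mk⇔ split (λ (d≡0 , r≡0) → trans (%!-suc t j) (cong₂ (λ a b → a * j ! + b) d≡0 r≡0))
  where
  split : t %! suc j ≡ 0 → digit t j ≡ 0 × t %! j ≡ 0
  split eq = [ id , (λ j!≡0 → contradiction j!≡0 (≢-nonZero⁻¹ (j !) {{j !≢0}})) ]′ (m*n≡0⇒m≡0∨n≡0 (digit t j) (m+n≡0⇒m≡0 _ sum≡0)) ,
             m+n≡0⇒n≡0 _ sum≡0
    where
    sum≡0 : digit t j * j ! + t %! j ≡ 0
    sum≡0 = trans (sym (%!-suc t j)) eq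

%6≡digits : ∀ t → t % 6 ≡ digit t 2 * 2 + digit t 1
%6≡digits t = trans (%!-suc t 2) (cong (digit t 2 * 2 +_) (%!-two t))

-- The full code (ℓ_{m-1}, …, ℓ₁, ℓ₀) of π^(t) ∈ 𝔖ₘ, including the trailing ℓ₀ = 0.
digits : ℕ → ℕ → List ℕ
digits m t = map (digit t) (downFrom m)

length-digits : ∀ m t → length (digits m t) ≡ m
length-digits m t = trans (length-map _ (downFrom m)) (length-downFrom m)

isCode-digits : ∀ m t → IsCode (digits m t)
isCode-digits zero t = tt
isCode-digits (suc m) t = subst (digit t m ≤_) (sym (length-digits m t)) (digit≤ t m) , isCode-digits m t

digits≡factoradic∷ʳ0 : ∀ n t → digits (suc n) t ≡ factoradic (suc n) t ++ (0 ∷ [])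
digits≡factoradic∷ʳ0 n t = begin
  map d (downFrom (suc n))                              ≡⟨ cong (map d) (downFrom-∷ʳ n) ⟨
  map d (List.applyDownFrom suc n ++ (0 ∷ []))         ≡⟨ map-++ d (List.applyDownFrom suc n) (0 ∷ []) ⟩
  map d (List.applyDownFrom suc n) ++ (d 0 ∷ [])       ≡⟨ cong₂ (λ xs z → map d xs ++ (z ∷ [])) (map-downFrom suc n) (sym (digit-zero t)) ⟨
  factoradic (suc n) t ++ (0 ∷ [])                      ∎
  where
  open ≡-Reasoning
  d = digit t

smallerToRight≡lehmerCode∷ʳ0 : ∀ x xs → smallerToRight (x ∷ xs) ≡ lehmerCode (x ∷ xs) ++ (0 ∷ [])
smallerToRight≡lehmerCode∷ʳ0 x [] = refl
smallerToRight≡lehmerCode∷ʳ0 x (y ∷ xs) = cong (countBelow x (y ∷ xs) ∷_) (smallerToRight≡lehmerCode∷ʳ0 y xs)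

isPermOfIndex⇔ : ∀ n b π → IsPermOfIndex (suc n) b π ⇔ (IsPerm (suc n) π × smallerToRight π ≡ digits (suc n) b)
isPermOfIndex⇔ n b [] = mk⇔ (λ (p , _) → contradiction (length-perm p) λ ()) (λ (p , _) → contradiction (length-perm p) λ ())
isPermOfIndex⇔ n b (x ∷ xs) = mk⇔
  (λ (p , c) → p , trans (smallerToRight≡lehmerCode∷ʳ0 x xs) (trans (cong (_++ (0 ∷ [])) c) (sym (digits≡factoradic∷ʳ0 n b))))
  (λ (p , c) → p , ++-cancelʳ (0 ∷ []) _ _ (trans (sym (smallerToRight≡lehmerCode∷ʳ0 x xs)) (trans c (digits≡factoradic∷ʳ0 n b))))

digits-cong : ∀ i {t t′} → (∀ j → j < i → digit t j ≡ digit t′ j) → digits i t ≡ digits i t′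
digits-cong zero _ = refl
digits-cong (suc i) same = cong₂ _∷_ (same i ≤-refl) (digits-cong i (λ j j<i → same j (m<n⇒m<1+n j<i)))

digits-injective-digit : ∀ i {t t′} → digits i t ≡ digits i t′ → ∀ j → j < i → digit t j ≡ digit t′ j
digits-injective-digit (suc i) eq j j<1+i with m<1+n⇒m<n∨m≡n j<1+i
... | inj₁ j<i = digits-injective-digit i (∷-injectiveʳ eq) j j<i
... | inj₂ refl = ∷-injectiveˡ eq

%!-cong : ∀ i {t t′} → (∀ j → j < i → digit t j ≡ digit t′ j) → t %! i ≡ t′ %! i
%!-cong zero {t} {t′} _ = trans (%!-zero t) (sym (%!-zero t′))
%!-cong (suc i) {t} {t′} same = begin
  t %! suc i                   ≡⟨ %!-suc t i ⟩
  digit t i * i ! + t %! i     ≡⟨ cong₂ (λ a b → a * i ! + b) (same i ≤-refl) (%!-cong i (λ j j<i → same j (m<n⇒m<1+n j<i))) ⟩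
  digit t′ i * i ! + t′ %! i   ≡⟨ %!-suc t′ i ⟨
  t′ %! suc i                  ∎
  where open ≡-Reasoning

digits-injective : ∀ m {t t′} → t < m ! → t′ < m ! → digits m t ≡ digits m t′ → t ≡ t′
digits-injective m {t} {t′} t< t′< eq = begin
  t         ≡⟨ %!-of-< m t< ⟨
  t %! m    ≡⟨ %!-cong m (digits-injective-digit m eq) ⟩
  t′ %! m   ≡⟨ %!-of-< m t′< ⟩
  t′        ∎
  where open ≡-Reasoning

encode : List ℕ → ℕ
encode [] = 0
encode (d ∷ ds) = d * length ds ! + encode ds

leadingDigit< : ∀ {d i e} → d ≤ i → e < i ! → d * i ! + e < suc i !
leadingDigit< {d} {i} {e} d≤i e<i! = begin-strict
  d * i ! + e      <⟨ +-monoʳ-< (d * i !) e<i! ⟩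
  d * i ! + i !    ≤⟨ +-monoˡ-≤ (i !) (*-monoˡ-≤ (i !) d≤i) ⟩
  i * i ! + i !    ≡⟨ +-comm (i * i !) (i !) ⟩
  suc i !          ∎
  where open ≤-Reasoning

encode< : ∀ ds → IsCode ds → encode ds < length ds !
encode< [] _ = s≤s z≤n
encode< (d ∷ ds) (d≤ , c) = leadingDigit< d≤ (encode< ds c)

digit-leading : ∀ {d i e} → d ≤ i → e < i ! → digit (d * i ! + e) i ≡ d
digit-leading {d} {i} {e} d≤i e<i! = begin
  digit t i                  ≡⟨ digit≡%!/ t i ⟩
  t %! suc i / i !           ≡⟨ cong (_/ i !) (%!-of-< (suc i) (leadingDigit< d≤i e<i!)) ⟩
  t / i !                    ≡⟨ +-distrib-/-∣ˡ e (n∣m*n d) ⟩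
  d * i ! / i ! + e / i !    ≡⟨ cong₂ _+_ (m*n/n≡m d (i !)) (m<n⇒m/n≡0 e<i!) ⟩
  d + 0                      ≡⟨ +-identityʳ d ⟩
  d                          ∎
  where
  open ≡-Reasoning
  instance _ = i !≢0
  t = d * i ! + e

digit-lower : ∀ a {i} e {j} → j < i → digit (a * i ! + e) j ≡ digit e j
digit-lower a {i} e {j} j<i = begin
  digit (a * i ! + e) j              ≡⟨ digit≡%!/ (a * i ! + e) j ⟩
  (a * i ! + e) %! suc j / j !       ≡⟨ cong (_/ j !) (%-remove-+ˡ e (∣n⇒∣m*n a (m≤n⇒m!∣n! j<i))) ⟩
  e %! suc j / j !                   ≡⟨ digit≡%!/ e j ⟨
  digit e j                          ∎
  where
  open ≡-Reasoning
  instance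
    _ = j !≢0
    _ = suc j !≢0

digits-encode : ∀ ds → IsCode ds → digits (length ds) (encode ds) ≡ ds
digits-encode [] _ = refl
digits-encode (d ∷ ds) (d≤ , c) = cong₂ _∷_ (digit-leading d≤ (encode< ds c))
  (trans (digits-cong (length ds) (λ j j< → digit-lower d (encode ds) j<)) (digits-encode ds c))

des-smallerToRight : ∀ {π} → Unique π → des (smallerToRight π) ≡ des π
des-smallerToRight u = cong length (descentsFrom-smallerToRight 1 _ u)

maxDes-smallerToRight : ∀ {π} → Unique π → maxDes (smallerToRight π) ≡ maxDes π
maxDes-smallerToRight u = cong (foldr _⊔_ 0) (descentsFrom-smallerToRight 1 _ u)

permOfIndex : ℕ → ℕ → List ℕ
permOfIndex m t = fromCode (digits m t)

isPerm-permOfIndex : ∀ m t → IsPerm m (permOfIndex m t)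
isPerm-permOfIndex m t = from isPerm⇔isPermSet
  (subst (λ k → IsPermSet k (permOfIndex m t)) (length-digits m t) (isPermSet-fromCode (digits m t) (isCode-digits m t)))

smallerToRight-permOfIndex : ∀ m t → smallerToRight (permOfIndex m t) ≡ digits m t
smallerToRight-permOfIndex m t = smallerToRight-fromCode (digits m t) (isCode-digits m t)

perm-injective-smallerToRight : ∀ {m π π′} → IsPerm m π → IsPerm m π′ → smallerToRight π ≡ smallerToRight π′ → π ≡ π′
perm-injective-smallerToRight {m} {π} {π′} p p′ =
  smallerToRight-injective π π′ (proj₁ s) (proj₁ s′) (λ x → mk⇔ (λ x∈ → from (proj₂ s′ x) (to (proj₂ s x) x∈)) (λ x∈ → from (proj₂ s x) (to (proj₂ s′ x) x∈)))
  where
  s = to isPerm⇔isPermSet p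
  s′ = to isPerm⇔isPermSet p′

permOfIndex-injective : ∀ m {t t′} → t < m ! → t′ < m ! → permOfIndex m t ≡ permOfIndex m t′ → t ≡ t′
permOfIndex-injective m {t} {t′} t< t′< eq = digits-injective m t< t′<
  (trans (sym (smallerToRight-permOfIndex m t)) (trans (cong smallerToRight eq) (smallerToRight-permOfIndex m t′)))

permOfIndex-surjective : ∀ m {π} → IsPerm m π → Σ ℕ λ t → t < m ! × permOfIndex m t ≡ π
permOfIndex-surjective m {π} p = encode c , t< , perm-injective-smallerToRight (isPerm-permOfIndex m (encode c)) p
  (trans (smallerToRight-permOfIndex m (encode c)) codeOfIndex)
  where
  c = smallerToRight π
  length-c : length c ≡ m
  length-c = trans (length-smallerToRight π) (length-perm p)
  t< : encode c < m !
  t< = subst (λ k → encode c < k !) length-c (encode< c (isCode-smallerToRight π))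
  codeOfIndex : digits m (encode c) ≡ c
  codeOfIndex = subst (λ k → digits k (encode c) ≡ c) length-c (digits-encode c (isCode-smallerToRight π))

unique-permOfIndex : ∀ m t → Unique (permOfIndex m t)
unique-permOfIndex m t = proj₁ (to isPerm⇔isPermSet (isPerm-permOfIndex m t))

des-permOfIndex : ∀ m t → des (permOfIndex m t) ≡ des (digits m t)
des-permOfIndex m t = trans (sym (des-smallerToRight (unique-permOfIndex m t))) (cong des (smallerToRight-permOfIndex m t))

maxDes-permOfIndex : ∀ m t → maxDes (permOfIndex m t) ≡ maxDes (digits m t)
maxDes-permOfIndex m t = trans (sym (maxDes-smallerToRight (unique-permOfIndex m t))) (cong maxDes (smallerToRight-permOfIndex m t))

des-isPermOfIndex : ∀ {n b π} → IsPermOfIndex (suc n) b π → des π ≡ des (digits (suc n) b)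
des-isPermOfIndex {n} {b} {π} idx = trans (sym (des-smallerToRight (proj₁ (to isPerm⇔isPermSet p)))) (cong des code≡)
  where
  p = proj₁ (to (isPermOfIndex⇔ n b π) idx)
  code≡ = proj₂ (to (isPermOfIndex⇔ n b π) idx)

-- Counting

count : {P : ℕ → Set} → Decidable P → ℕ → ℕ
count P? N = length (filter P? (upTo N))

count-suc : ∀ {P : ℕ → Set} (P? : Decidable P) N → count P? (suc N) ≡ count P? N + (if does (P? N) then 1 else 0)
count-suc P? N = begin
  length (filter P? (upTo (suc N)))                    ≡⟨ cong (length ∘ filter P?) (upTo-∷ʳ N) ⟨
  length (filter P? (upTo N ++ (N ∷ [])))             ≡⟨ cong length (filter-++ P? (upTo N) (N ∷ [])) ⟩
  length (filter P? (upTo N) ++ filter P? (N ∷ []))   ≡⟨ length-++ (filter P? (upTo N)) ⟩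
  count P? N + length (filter P? (N ∷ []))             ≡⟨ cong (count P? N +_) lastEntry ⟩
  count P? N + (if does (P? N) then 1 else 0)          ∎
  where
  open ≡-Reasoning
  lastEntry : length (filter P? (N ∷ [])) ≡ (if does (P? N) then 1 else 0)
  lastEntry with does (P? N)
  ... | true = refl
  ... | false = refl

count-suc-yes : ∀ {P : ℕ → Set} (P? : Decidable P) {N} → P N → count P? (suc N) ≡ suc (count P? N)
count-suc-yes P? {N} p = trans (count-suc P? N) (trans (cong (λ b → count P? N + (if b then 1 else 0)) (dec-true (P? N) p)) (+-comm _ 1))

count-suc-no : ∀ {P : ℕ → Set} (P? : Decidable P) {N} → ¬ P N → count P? (suc N) ≡ count P? N
count-suc-no P? {N} ¬p = trans (count-suc P? N) (trans (cong (λ b → count P? N + (if b then 1 else 0)) (dec-false (P? N) ¬p)) (+-identityʳ _))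

count-cong : ∀ {P Q : ℕ → Set} (P? : Decidable P) (Q? : Decidable Q) N → (∀ j → j < N → P j ⇔ Q j) → count P? N ≡ count Q? N
count-cong P? Q? zero _ = refl
count-cong P? Q? (suc N) P⇔Q with P? N
... | yes p = trans (count-suc-yes P? p) (trans (cong suc (count-cong P? Q? N below)) (sym (count-suc-yes Q? (to (P⇔Q N ≤-refl) p))))
  where below = λ j j<N → P⇔Q j (m<n⇒m<1+n j<N)
... | no ¬p = trans (count-suc-no P? ¬p) (trans (count-cong P? Q? N below) (sym (count-suc-no Q? (¬p ∘ from (P⇔Q N ≤-refl)))))
  where below = λ j j<N → P⇔Q j (m<n⇒m<1+n j<N)

count-+ : ∀ {P : ℕ → Set} (P? : Decidable P) a b → count P? (a + b) ≡ count P? a + count (P? ∘ (a +_)) b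
count-+ P? a zero = trans (cong (count P?) (+-identityʳ a)) (sym (+-identityʳ _))
count-+ P? a (suc b) = begin
  count P? (a + suc b)                                         ≡⟨ cong (count P?) (+-suc a b) ⟩
  count P? (suc (a + b))                                       ≡⟨ count-suc P? (a + b) ⟩
  count P? (a + b) + last                                      ≡⟨ cong (_+ last) (count-+ P? a b) ⟩
  count P? a + count (P? ∘ (a +_)) b + last                    ≡⟨ +-assoc (count P? a) _ last ⟩
  count P? a + (count (P? ∘ (a +_)) b + last)                  ≡⟨ cong (count P? a +_) (count-suc (P? ∘ (a +_)) b) ⟨
  count P? a + count (P? ∘ (a +_)) (suc b)                     ∎
  where
  open ≡-Reasoning
  last = if does (P? (a + b)) then 1 else 0

count-periodic : ∀ {P : ℕ → Set} (P? : Decidable P) d → (∀ j → P (d + j) ⇔ P j) → ∀ c → count P? (c * d) ≡ c * count P? d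
count-periodic P? d periodic zero = refl
count-periodic P? d periodic (suc c) = begin
  count P? (d + c * d)                     ≡⟨ count-+ P? d (c * d) ⟩
  count P? d + count (P? ∘ (d +_)) (c * d) ≡⟨ cong (count P? d +_) (count-cong (P? ∘ (d +_)) P? (c * d) (λ j _ → periodic j)) ⟩
  count P? d + count P? (c * d)            ≡⟨ cong (count P? d +_) (count-periodic P? d periodic c) ⟩
  count P? d + c * count P? d              ∎
  where open ≡-Reasoning

count-⊇ : ∀ {P Q : ℕ → Set} (P? : Decidable P) (Q? : Decidable Q) → (∀ {j} → Q j → P j) → ∀ N →
  count P? N ≡ count (λ j → P? j ×-dec ¬? (Q? j)) N + count Q? N
count-⊇ P? Q? Q⇒P zero = refl
count-⊇ P? Q? Q⇒P (suc N) with P? N | Q? N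
... | yes p | yes q = begin
  count P? (suc N)                  ≡⟨ count-suc-yes P? p ⟩
  suc (count P? N)                  ≡⟨ cong suc (count-⊇ P? Q? Q⇒P N) ⟩
  suc (count R? N + count Q? N)     ≡⟨ +-suc (count R? N) _ ⟨
  count R? N + suc (count Q? N)     ≡⟨ cong₂ _+_ (count-suc-no R? (λ (_ , ¬q) → ¬q q)) (count-suc-yes Q? q) ⟨
  count R? (suc N) + count Q? (suc N) ∎
  where
  open ≡-Reasoning
  R? = λ j → P? j ×-dec ¬? (Q? j)
... | yes p | no ¬q = trans (count-suc-yes P? p) (trans (cong suc (count-⊇ P? Q? Q⇒P N))
    (sym (cong₂ _+_ (count-suc-yes (λ j → P? j ×-dec ¬? (Q? j)) (p , ¬q)) (count-suc-no Q? ¬q))))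
... | no ¬p | yes q = contradiction (Q⇒P q) ¬p
... | no ¬p | no ¬q = trans (count-suc-no P? ¬p) (trans (count-⊇ P? Q? Q⇒P N)
    (sym (cong₂ _+_ (count-suc-no (λ j → P? j ×-dec ¬? (Q? j)) (¬p ∘ proj₁)) (count-suc-no Q? ¬q))))

count-multiples : ∀ d .{{_ : NonZero d}} c → count (λ t → t % d ≟ 0) (c * d) ≡ c
count-multiples d@(suc d′) c = trans (count-periodic (λ t → t % d ≟ 0) d periodic c) (trans (cong (c *_) once) (*-identityʳ c))
  where
  periodic : ∀ j → (d + j) % d ≡ 0 ⇔ j % d ≡ 0
  periodic j = mk⇔ (trans (sym (%-remove-+ˡ j (∣-refl {d})))) (trans (%-remove-+ˡ j (∣-refl {d})))
  onlyZero : ∀ r → r < d → count (λ t → t % d ≟ 0) (suc r) ≡ 1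
  onlyZero zero _ = count-suc-yes (λ t → t % d ≟ 0) {0} refl
  onlyZero (suc r) r<d = trans (count-suc-no (λ t → t % d ≟ 0) (λ eq → contradiction (trans (sym (m<n⇒m%n≡m r<d)) eq) λ ()))
                               (onlyZero r (<-trans (n<1+n r) r<d))
  once : count (λ t → t % d ≟ 0) d ≡ 1
  once = onlyZero d′ ≤-refl

Unique-map⁺-on : ∀ {A B : Set} (f : A → B) {xs} → (∀ {x y} → x ∈ xs → y ∈ xs → f x ≡ f y → x ≡ y) → Unique xs → Unique (map f xs)
Unique-map⁺-on f inj [] = []
Unique-map⁺-on f {x ∷ xs} inj (x∉ ∷ u) = distinct xs x∉ (λ y∈ → inj (here refl) (there y∈)) ∷ Unique-map⁺-on f (λ x∈ y∈ → inj (there x∈) (there y∈)) u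
  where
  distinct : ∀ ys → All (x ≢_) ys → (∀ {y} → y ∈ ys → f x ≡ f y → x ≡ y) → All (f x ≢_) (map f ys)
  distinct [] [] _ = []
  distinct (y ∷ ys) (x≢y ∷ x≢ys) inj′ = (λ eq → x≢y (inj′ (here refl) eq)) ∷ distinct ys x≢ys (inj′ ∘ there)

hasCard-image : ∀ {B : Set} (f : ℕ → B) {P : ℕ → Set} (P? : Decidable P) N →
  (∀ {t t′} → t < N × P t → t′ < N × P t′ → f t ≡ f t′ → t ≡ t′) →
  {Q : B → Set} → (∀ x → Q x ⇔ (Σ ℕ λ t → (t < N × P t) × f t ≡ x)) → HasCard Q (count P? N)
hasCard-image f P? N inj {Q} Q⇔ = map f L , Unique-map⁺-on f (λ t∈ t′∈ → inj (to ∈L⇔ t∈) (to ∈L⇔ t′∈)) (Unique.filter⁺ P? (Unique.upTo⁺ N)) ,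
  length-map f L , members
  where
  L = filter P? (upTo N)
  ∈L⇔ : ∀ {t} → t ∈ L ⇔ (t < N × _)
  ∈L⇔ = mk⇔ (λ t∈ → map₁ ∈-upTo⁻ (∈-filter⁻ P? t∈)) (λ (t<N , p) → ∈-filter⁺ P? (∈-upTo⁺ t<N) p)
  members : ∀ x → Q x ⇔ x ∈ map f L
  members x = mk⇔ (λ Qx → let (t , tP , ft≡x) = to (Q⇔ x) Qx in subst (_∈ map f L) ft≡x (∈-map⁺ f (from ∈L⇔ tP)))
                  (λ x∈ → let (t , t∈ , x≡ft) = ∈-map⁻ f x∈ in from (Q⇔ x) (t , to ∈L⇔ t∈ , sym x≡ft))


-- Descents of factoradic digit lists

descentsFrom-suc : ∀ i xs → descentsFrom (suc i) xs ≡ map suc (descentsFrom i xs)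
descentsFrom-suc i [] = refl
descentsFrom-suc i (x ∷ []) = refl
descentsFrom-suc i (a ∷ b ∷ r) = shifted (b <ᵇ a) (descentsFrom-suc (suc i) (b ∷ r))
  where
  shifted : ∀ c {X Y} → X ≡ map suc Y → (if c then suc i ∷ X else X) ≡ map suc (if c then i ∷ Y else Y)
  shifted true eq = cong (suc i ∷_) eq
  shifted false eq = eq

maximum : List ℕ → ℕ
maximum = foldr _⊔_ 0

maximum-map-suc : ∀ x xs → maximum (map suc (x ∷ xs)) ≡ suc (maximum (x ∷ xs))
maximum-map-suc x [] = cong suc (sym (⊔-identityʳ x))
maximum-map-suc x (y ∷ xs) = cong (suc x ⊔_) (maximum-map-suc y xs)

extendMaxDes : Bool → ℕ → ℕ
extendMaxDes descent zero = if descent then 1 else 0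
extendMaxDes _ (suc k) = suc (suc k)

maxDes-shift : ∀ xs → (maxDes xs ≡ 0 × descentsFrom 2 xs ≡ []) ⊎ Σ ℕ λ k → maxDes xs ≡ suc k × maximum (descentsFrom 2 xs) ≡ suc (suc k)
maxDes-shift xs with descentsFrom 0 xs in eq
... | [] = inj₁ (cong maximum from1 , trans (descentsFrom-suc 1 xs) (cong (map suc) from1))
  where
  from1 : descentsFrom 1 xs ≡ []
  from1 = trans (descentsFrom-suc 0 xs) (cong (map suc) eq)
... | d ∷ ds = inj₂ (maximum (d ∷ ds) , trans (cong maximum from1) (maximum-map-suc d ds) ,
    trans (cong maximum (trans (descentsFrom-suc 1 xs) (cong (map suc) from1)))
          (trans (maximum-map-suc (suc d) (map suc ds)) (cong suc (maximum-map-suc d ds))))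
  where
  from1 : descentsFrom 1 xs ≡ map suc (d ∷ ds)
  from1 = trans (descentsFrom-suc 0 xs) (cong (map suc) eq)

maxDes-∷∷ : ∀ a b r → maxDes (a ∷ b ∷ r) ≡ extendMaxDes (b <ᵇ a) (maxDes (b ∷ r))
maxDes-∷∷ a b r with maxDes-shift (b ∷ r)
... | inj₁ (m≡0 , D≡[]) = noLaterDescent (b <ᵇ a) D≡[] m≡0
  where
  noLaterDescent : ∀ c {D M} → D ≡ [] → M ≡ 0 → maximum (if c then 1 ∷ D else D) ≡ extendMaxDes c M
  noLaterDescent true refl refl = refl
  noLaterDescent false refl refl = refl
... | inj₂ (k , m≡ , maxD≡) = laterDescent (b <ᵇ a) maxD≡ m≡
  where
  laterDescent : ∀ c {D M} → maximum D ≡ suc (suc k) → M ≡ suc k → maximum (if c then 1 ∷ D else D) ≡ extendMaxDes c M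
  laterDescent true eq refl = cong (1 ⊔_) eq
  laterDescent false eq refl = eq

extendMaxDes≡0⇔ : ∀ {P : Set} (P? : Dec P) m → extendMaxDes (does P?) m ≡ 0 ⇔ (m ≡ 0 × ¬ P)
extendMaxDes≡0⇔ (yes p) zero = mk⇔ (λ ()) (λ (_ , ¬p) → contradiction p ¬p)
extendMaxDes≡0⇔ (no ¬p) zero = mk⇔ (λ _ → refl , ¬p) (λ _ → refl)
extendMaxDes≡0⇔ P? (suc m) = mk⇔ (λ ()) (λ ())

extendMaxDes≡1⇔ : ∀ {P : Set} (P? : Dec P) m → extendMaxDes (does P?) m ≡ 1 ⇔ (m ≡ 0 × P)
extendMaxDes≡1⇔ (yes p) zero = mk⇔ (λ _ → refl , p) (λ _ → refl)
extendMaxDes≡1⇔ (no ¬p) zero = mk⇔ (λ ()) (λ (_ , p) → contradiction p ¬p)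
extendMaxDes≡1⇔ P? (suc m) = mk⇔ (λ ()) (λ ())

extendMaxDes≡2+⇔ : ∀ c m k → extendMaxDes c m ≡ suc (suc k) ⇔ m ≡ suc k
extendMaxDes≡2+⇔ true zero k = mk⇔ (λ ()) (λ ())
extendMaxDes≡2+⇔ false zero k = mk⇔ (λ ()) (λ ())
extendMaxDes≡2+⇔ c (suc m) k = mk⇔ (λ eq → suc-injective eq) (cong suc)

maxDes-digits≡0⇔ : ∀ j t → maxDes (digits j t) ≡ 0 ⇔ t %! j ≡ 0
maxDes-digits≡0⇔ zero t = mk⇔ (λ _ → %!-zero t) (λ _ → refl)
maxDes-digits≡0⇔ (suc zero) t = mk⇔ (λ _ → %!-one t) (λ _ → refl)
maxDes-digits≡0⇔ (suc (suc i)) t = mk⇔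
  (λ eq → let (M≡0 , ≮) = to (extendMaxDes≡0⇔ (d i <? d (suc i)) M) (trans (sym head) eq)
              (di≡0 , r≡0) = to (%!-suc≡0⇔ t i) (to (maxDes-digits≡0⇔ (suc i) t) M≡0)
          in from (%!-suc≡0⇔ t (suc i)) (n≤0⇒n≡0 (subst (d (suc i) ≤_) di≡0 (≮⇒≥ ≮)) , from (%!-suc≡0⇔ t i) (di≡0 , r≡0)))
  (λ eq → let (dsi≡0 , r≡0) = to (%!-suc≡0⇔ t (suc i)) eq
          in trans head (from (extendMaxDes≡0⇔ (d i <? d (suc i)) M) (from (maxDes-digits≡0⇔ (suc i) t) r≡0 , λ lt → contradiction (subst (d i <_) dsi≡0 lt) λ ())))
  where
  d = digit t
  M = maxDes (digits (suc i) t)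
  head : maxDes (digits (suc (suc i)) t) ≡ extendMaxDes (d i <ᵇ d (suc i)) M
  head = maxDes-∷∷ (d (suc i)) (d i) (digits i t)

-- The largest descent of the code sits where the trailing zero block t %! a ≡ 0 ends.
maxDes-digits≡suc⇔ : ∀ k a t → 1 ≤ a → maxDes (digits (suc k + a) t) ≡ suc k ⇔ (t %! a ≡ 0 × t %! suc a ≢ 0)
maxDes-digits≡suc⇔ zero (suc i) t _ = mk⇔
  (λ eq → let (M≡0 , lt) = to (extendMaxDes≡1⇔ (d i <? d (suc i)) M) (trans (sym head) eq)
              r≡0 = to (maxDes-digits≡0⇔ (suc i) t) M≡0
          in r≡0 , λ rs≡0 → <⇒≢ lt (trans (proj₁ (to (%!-suc≡0⇔ t i) r≡0)) (sym (proj₁ (to (%!-suc≡0⇔ t (suc i)) rs≡0)))))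
  (λ (r≡0 , rs≢0) → trans head (from (extendMaxDes≡1⇔ (d i <? d (suc i)) M) (from (maxDes-digits≡0⇔ (suc i) t) r≡0 ,
     subst (_< d (suc i)) (sym (proj₁ (to (%!-suc≡0⇔ t i) r≡0))) (n≢0⇒n>0 λ dsi≡0 → rs≢0 (from (%!-suc≡0⇔ t (suc i)) (dsi≡0 , r≡0))))))
  where
  d = digit t
  M = maxDes (digits (suc i) t)
  head : maxDes (digits (suc (suc i)) t) ≡ extendMaxDes (d i <ᵇ d (suc i)) M
  head = maxDes-∷∷ (d (suc i)) (d i) (digits i t)
maxDes-digits≡suc⇔ (suc k) a t 1≤a = mk⇔
  (λ eq → to (maxDes-digits≡suc⇔ k a t 1≤a) (to (extendMaxDes≡2+⇔ _ _ k) (trans (sym head) eq)))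
  (λ h → trans head (from (extendMaxDes≡2+⇔ _ _ k) (from (maxDes-digits≡suc⇔ k a t 1≤a) h)))
  where
  head : maxDes (digits (suc (suc k) + a) t) ≡ extendMaxDes (digit t (k + a) <ᵇ digit t (suc (k + a))) (maxDes (digits (suc k + a) t))
  head = maxDes-∷∷ (digit t (suc (k + a))) (digit t (k + a)) (digits (k + a) t)

ascent? : (f : ℕ → ℕ) → Decidable (λ j → f j < f (suc j))
ascent? f j = f j <? f (suc j)

ascents : (ℕ → ℕ) → ℕ → ℕ
ascents f = count (ascent? f)

des-tail : ∀ b r → length (descentsFrom 2 (b ∷ r)) ≡ des (b ∷ r)
des-tail b r = trans (cong length (descentsFrom-suc 1 (b ∷ r))) (length-map suc (descentsFrom 1 (b ∷ r)))

des-∷-> : ∀ {a b} r → b < a → des (a ∷ b ∷ r) ≡ suc (des (b ∷ r))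
des-∷-> {b = b} r b<a = trans (cong length (descentsFrom-> 1 r b<a)) (cong suc (des-tail b r))

des-∷-≯ : ∀ {a b} r → ¬ b < a → des (a ∷ b ∷ r) ≡ des (b ∷ r)
des-∷-≯ {b = b} r b≮a = trans (cong length (descentsFrom-≯ 1 r b≮a)) (des-tail b r)

des-digits : ∀ k t → des (digits (suc k) t) ≡ ascents (digit t) k
des-digits zero t = refl
des-digits (suc k) t with digit t k <? digit t (suc k)
... | yes lt = trans (des-∷-> (digits k t) lt) (trans (cong suc (des-digits k t)) (sym (count-suc-yes (ascent? (digit t)) lt)))
... | no ¬lt = trans (des-∷-≯ (digits k t) ¬lt) (trans (des-digits k t) (sym (count-suc-no (ascent? (digit t)) ¬lt)))

-- The numbers b_{m,k}

infix 8 _!/_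

_!/_ : ℕ → ℕ → ℕ
m !/ j = (m ! / j !) {{j !≢0}}

!*!/ : ∀ {m j} → j ≤ m → j ! * m !/ j ≡ m !
!*!/ {m} {j} j≤m = m*[n/m]≡n {{j !≢0}} (m≤n⇒m!∣n! j≤m)

!/-suc : ∀ {m j} → j < m → m !/ j ≡ suc j * m !/ suc j
!/-suc {m} {j} j<m = *-cancelˡ-≡ (m !/ j) (suc j * m !/ suc j) (j !) {{j !≢0}} (begin
  j ! * m !/ j                 ≡⟨ !*!/ (<⇒≤ j<m) ⟩
  m !                          ≡⟨ !*!/ j<m ⟨
  suc j ! * m !/ suc j         ≡⟨ cong (_* m !/ suc j) (*-comm (suc j) (j !)) ⟩
  j ! * suc j * m !/ suc j     ≡⟨ *-assoc (j !) (suc j) _ ⟩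
  j ! * (suc j * m !/ suc j)   ∎)
  where open ≡-Reasoning

!/-self : ∀ m → m !/ m ≡ 1
!/-self m = n/n≡1 (m !) {{m !≢0}}

!/-one : ∀ m → m !/ 1 ≡ m !
!/-one m = n/1≡n (m !)

!/-pos : ∀ {m j} → j ≤ m → 0 < m !/ j
!/-pos {m} {j} j≤m = n≢0⇒n>0 λ eq → ≢-nonZero⁻¹ (m !) {{m !≢0}} (trans (sym (!*!/ j≤m)) (trans (cong (j ! *_) eq) (*-zeroʳ (j !))))

!/-suc≤ : ∀ {m j} → j < m → m !/ suc j ≤ m !/ j
!/-suc≤ {m} {j} j<m = subst (m !/ suc j ≤_) (sym (!/-suc j<m)) (m≤n*m (m !/ suc j) (suc j))

count-%!≡0 : ∀ {m j} → j ≤ m → count (λ t → t %! j ≟ 0) (m !) ≡ m !/ j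
count-%!≡0 {m} {j} j≤m = trans (cong (count (λ t → t %! j ≟ 0)) (trans (sym (!*!/ j≤m)) (*-comm (j !) (m !/ j))))
  (count-multiples (j !) {{j !≢0}} (m !/ j))

FactorialOrder : ℕ → ℕ → Set
FactorialOrder a t = t %! a ≡ 0 × t %! suc a ≢ 0

factorialOrder? : ∀ a → Decidable (FactorialOrder a)
factorialOrder? a t = (t %! a ≟ 0) ×-dec ¬? (t %! suc a ≟ 0)

count-factorialOrder : ∀ {m a} → a < m → count (factorialOrder? a) (m !) ≡ m !/ a ∸ m !/ suc a
count-factorialOrder {m} {a} a<m = begin
  count (factorialOrder? a) (m !)                                                         ≡⟨ m+n∸n≡m _ (count (λ t → t %! suc a ≟ 0) (m !)) ⟨
  count (factorialOrder? a) (m !) + count (λ t → t %! suc a ≟ 0) (m !) ∸ count (λ t → t %! suc a ≟ 0) (m !)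
    ≡⟨ cong (_∸ count (λ t → t %! suc a ≟ 0) (m !)) (count-⊇ (λ t → t %! a ≟ 0) (λ t → t %! suc a ≟ 0) (λ {t} → proj₂ ∘ to (%!-suc≡0⇔ t a)) (m !)) ⟨
  count (λ t → t %! a ≟ 0) (m !) ∸ count (λ t → t %! suc a ≟ 0) (m !)                     ≡⟨ cong₂ _∸_ (count-%!≡0 (<⇒≤ a<m)) (count-%!≡0 a<m) ⟩
  m !/ a ∸ m !/ suc a                                                                      ∎
  where open ≡-Reasoning

-- b_{M,k+1} counts the t < M! of factorial order a = M − (k+1), through t ↦ π^(t).
maxDesCount : ∀ {M q} → IsMaxDesCounts M q → ∀ k a → 1 ≤ a → suc k + a ≡ M → q (suc k) ≡ M !/ a ∸ M !/ suc a
maxDesCount {M} {q} hq k a 1≤a refl = trans (hasCard-unique (hq (suc k)) image) (count-factorialOrder {suc k + a} (s≤s (m≤n+m a k)))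
  where
  maxDes≡⇔ : ∀ t → maxDes (permOfIndex M t) ≡ suc k ⇔ FactorialOrder a t
  maxDes≡⇔ t = mk⇔ (λ eq → to (maxDes-digits≡suc⇔ k a t 1≤a) (trans (sym (maxDes-permOfIndex M t)) eq))
                   (λ o → trans (maxDes-permOfIndex M t) (from (maxDes-digits≡suc⇔ k a t 1≤a) o))
  image : HasCard (λ π → IsPerm M π × maxDes π ≡ suc k) (count (factorialOrder? a) (M !))
  image = hasCard-image (permOfIndex M) (factorialOrder? a) (M !) (λ (t< , _) (t′< , _) → permOfIndex-injective M t< t′<) λ π → mk⇔
    (λ (p , md) → let (t , t< , π≡) = permOfIndex-surjective M p in t , (t< , to (maxDes≡⇔ t) (trans (cong maxDes π≡) md)) , π≡)
    (λ (t , (_ , o) , π≡) → subst (λ σ → IsPerm M σ × maxDes σ ≡ suc k) π≡ (isPerm-permOfIndex M t , from (maxDes≡⇔ t) o))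

-- The residues t · m!/j! mod m!

scaled : ℕ → ℕ → ℕ → ℕ
scaled m t j = (t * m !/ j % m !) {{m !≢0}}

scaled< : ∀ m t j → scaled m t j < m !
scaled< m t j = m%n<n (t * m !/ j) (m !) {{m !≢0}}

scaled≡ : ∀ {m} t {j} → j ≤ m → scaled m t j ≡ t %! j * m !/ j
scaled≡ {m} t {j} j≤m = sym (trans (m%n*o≡m*o%[n*o] t (j !) (m !/ j) {{j !≢0}} {{nonZero}}) (%-congʳ {{nonZero}} {{m !≢0}} (!*!/ j≤m)))
  where
  nonZero : NonZero (j ! * m !/ j)
  nonZero = subst NonZero (sym (!*!/ j≤m)) (m !≢0)

scaled-one : ∀ {m} t → 1 ≤ m → scaled m t 1 ≡ 0
scaled-one {m} t 1≤m = trans (scaled≡ t 1≤m) (cong (_* m !/ 1) (%!-one t))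

scaled-self : ∀ {m t} → t < m ! → scaled m t m ≡ t
scaled-self {m} {t} t< = trans (scaled≡ {m} t ≤-refl) (trans (cong₂ _*_ (%!-of-< m t<) (!/-self m)) (*-identityʳ t))

mixedRadix-<⇔ : ∀ {a b f r} → r < f → a * f + r < b * f ⇔ a < b
mixedRadix-<⇔ {a} {b} {f} {r} r<f = mk⇔
  (λ lt → *-cancelʳ-< f a b (≤-<-trans (m≤m+n (a * f) r) lt))
  (λ a<b → begin-strict
    a * f + r  <⟨ +-monoʳ-< (a * f) r<f ⟩
    a * f + f  ≡⟨ +-comm (a * f) f ⟩
    suc a * f  ≤⟨ *-monoˡ-≤ f a<b ⟩
    b * f      ∎)
  where open ≤-Reasoning

mixedRadix-≡⇔ : ∀ {a b f r} → r < f → a * f + r ≡ b * f ⇔ (a ≡ b × r ≡ 0)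
mixedRadix-≡⇔ {a} {b} {f} {r} r<f = mk⇔ split (λ (a≡b , r≡0) → trans (cong₂ (λ x y → x * f + y) a≡b r≡0) (+-identityʳ (b * f)))
  where
  split : a * f + r ≡ b * f → a ≡ b × r ≡ 0
  split eq = a≡b , +-cancelˡ-≡ (a * f) r 0 (trans eq (trans (cong (_* f) (sym a≡b)) (sym (+-identityʳ (a * f)))))
    where
    a≡b : a ≡ b
    a≡b with <-cmp a b
    ... | tri< a<b _ _ = contradiction eq (<⇒≢ (from (mixedRadix-<⇔ r<f) a<b))
    ... | tri≈ _ a≡b _ = a≡b
    ... | tri> _ _ b<a = contradiction (sym eq) (<⇒≢ (<-≤-trans (*-monoˡ-< f {{>-nonZero (≤-<-trans z≤n r<f)}} b<a) (m≤m+n (a * f) r)))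

affine-<⇔ : ∀ {c p X Y Z} → .{{NonZero c}} → .{{NonZero p}} → (c * X + Z) * p < (c * Y + Z) * p ⇔ X < Y
affine-<⇔ {c} {p} {X} {Y} {Z} = mk⇔
  (λ lt → *-cancelˡ-< c X Y (+-cancelʳ-< Z (c * X) (c * Y) (*-cancelʳ-< p _ _ lt)))
  (λ X<Y → *-monoˡ-< p (+-monoˡ-< Z (*-monoʳ-< c X<Y)))

affine-≡⇔ : ∀ {c p X Y Z} → .{{NonZero c}} → .{{NonZero p}} → (c * X + Z) * p ≡ (c * Y + Z) * p ⇔ X ≡ Y
affine-≡⇔ {c} {p} {X} {Y} {Z} = mk⇔
  (λ eq → *-cancelˡ-≡ X Y c (+-cancelʳ-≡ Z (c * X) (c * Y) (*-cancelʳ-≡ _ _ p eq)))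
  (λ X≡Y → cong (λ x → (c * x + Z) * p) X≡Y)

module _ {m} (t i : ℕ) (2+i≤m : suc (suc i) ≤ m) where
  private
    p = m !/ suc (suc i)
    R₁ = t %! suc i
    Y = digit t (suc i) * i !
    instance
      _ = >-nonZero (!/-pos {m} 2+i≤m)

    scaled-suc : scaled m t (suc i) ≡ (suc i * R₁ + R₁) * p
    scaled-suc = begin
      scaled m t (suc i)               ≡⟨ scaled≡ t (≤-trans (n≤1+n (suc i)) 2+i≤m) ⟩
      R₁ * m !/ suc i                  ≡⟨ cong (R₁ *_) (!/-suc 2+i≤m) ⟩
      R₁ * (suc (suc i) * p)           ≡⟨ solve 3 (λ r k q → r :* ((con 2 :+ k) :* q) := ((con 1 :+ k) :* r :+ r) :* q) refl R₁ i p ⟩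
      (suc i * R₁ + R₁) * p            ∎
      where
      open ≡-Reasoning
      open +-*-Solver

    scaled-suc-suc : scaled m t (suc (suc i)) ≡ (suc i * Y + R₁) * p
    scaled-suc-suc = begin
      scaled m t (suc (suc i))                            ≡⟨ scaled≡ t 2+i≤m ⟩
      t %! suc (suc i) * p                                ≡⟨ cong (_* p) (%!-suc t (suc i)) ⟩
      (digit t (suc i) * suc i ! + R₁) * p                ≡⟨ cong (λ x → (x + R₁) * p) (solve 3 (λ d k f → d :* ((con 1 :+ k) :* f) := (con 1 :+ k) :* (d :* f)) refl (digit t (suc i)) i (i !)) ⟩
      (suc i * Y + R₁) * p                                ∎
      where
      open ≡-Reasoning
      open +-*-Solver

  scaled-<⇔ : scaled m t (suc i) < scaled m t (suc (suc i)) ⇔ digit t i < digit t (suc i)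
  scaled-<⇔ = begin
    scaled m t (suc i) < scaled m t (suc (suc i))        ≡⟨ cong₂ _<_ scaled-suc scaled-suc-suc ⟩
    (suc i * R₁ + R₁) * p < (suc i * Y + R₁) * p         ∼⟨ affine-<⇔ {suc i} ⟩
    R₁ < Y                                               ≡⟨ cong (_< Y) (%!-suc t i) ⟩
    digit t i * i ! + t %! i < Y                         ∼⟨ mixedRadix-<⇔ (%!<! t i) ⟩
    digit t i < digit t (suc i)                          ∎
    where open Related.EquationalReasoning

  scaled-≡⇔ : scaled m t (suc i) ≡ scaled m t (suc (suc i)) ⇔ (digit t i ≡ digit t (suc i) × t %! i ≡ 0)
  scaled-≡⇔ = begin
    scaled m t (suc i) ≡ scaled m t (suc (suc i))        ≡⟨ cong₂ _≡_ scaled-suc scaled-suc-suc ⟩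
    (suc i * R₁ + R₁) * p ≡ (suc i * Y + R₁) * p         ∼⟨ affine-≡⇔ {suc i} ⟩
    R₁ ≡ Y                                               ≡⟨ cong (_≡ Y) (%!-suc t i) ⟩
    digit t i * i ! + t %! i ≡ Y                         ∼⟨ mixedRadix-≡⇔ (%!<! t i) ⟩
    (digit t i ≡ digit t (suc i) × t %! i ≡ 0)           ∎
    where open Related.EquationalReasoning

UnitMod6 : ℕ → Set
UnitMod6 t = t % 6 ≡ 1 ⊎ t % 6 ≡ 5

unitMod6? : Decidable UnitMod6
unitMod6? t = (t % 6 ≟ 1) ⊎-dec (t % 6 ≟ 5)

unitMod6⇒≥1 : ∀ {t} → UnitMod6 t → 1 ≤ t
unitMod6⇒≥1 {suc _} _ = s≤s z≤n
unitMod6⇒≥1 {zero} (inj₁ ())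
unitMod6⇒≥1 {zero} (inj₂ ())

unitMod6⇒odd : ∀ {t} → UnitMod6 t → t % 2 ≡ 1
unitMod6⇒odd {t} u = trans (sym (m∣n⇒o%n%m≡o%m 2 6 t (divides 3 refl))) (reduce u)
  where
  reduce : UnitMod6 t → t % 6 % 2 ≡ 1
  reduce (inj₁ eq) = cong (_% 2) eq
  reduce (inj₂ eq) = cong (_% 2) eq

unitMod6-≤! : ∀ {m t} → 2 ≤ m → t ≤ m ! → UnitMod6 t → t < m !
unitMod6-≤! {m} {t} 2≤m t≤ u = ≤∧≢⇒< t≤ λ t≡ → contradiction (trans (sym (unitMod6⇒odd {t} u)) (trans (cong (_% 2) t≡) (n∣m⇒m%n≡0 (m !) 2 (m≤n⇒m!∣n! 2≤m)))) λ ()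

count-unitMod6 : ∀ c → count unitMod6? (c * 6) ≡ c * 2
count-unitMod6 = count-periodic unitMod6? 6 λ j → subst (λ r → UnitMod6 (6 + j) ⇔ (r ≡ 1 ⊎ r ≡ 5)) (trans (cong (_% 6) (+-comm 6 j)) ([m+n]%n≡m%n j 6)) (mk⇔ id id)

count-unitMod6-! : ∀ {m} → 3 ≤ m → count unitMod6? (m !) ≡ m ! / 3
count-unitMod6-! {m} 3≤m with m≤n⇒m!∣n! 3≤m
... | divides c m!≡c*6 = begin
  count unitMod6? (m !)    ≡⟨ cong (count unitMod6?) m!≡c*6 ⟩
  count unitMod6? (c * 6)  ≡⟨ count-unitMod6 c ⟩
  c * 2                    ≡⟨ m*n/n≡m (c * 2) 3 ⟨
  c * 2 * 3 / 3            ≡⟨ cong (_/ 3) (trans (*-assoc c 2 3) (sym m!≡c*6)) ⟩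
  m ! / 3                  ∎
  where open ≡-Reasoning

unitMod6⇔digits : ∀ {l₁ l₂} → l₁ ≤ 1 → l₂ ≤ 2 → (l₂ * 2 + l₁ ≡ 1 ⊎ l₂ * 2 + l₁ ≡ 5) ⇔ (l₁ ≡ 1 × l₂ ≢ 1)
unitMod6⇔digits {0} {0} _ _ = mk⇔ (λ { (inj₁ ()) ; (inj₂ ()) }) (λ { (() , _) })
unitMod6⇔digits {0} {1} _ _ = mk⇔ (λ { (inj₁ ()) ; (inj₂ ()) }) (λ { (() , _) })
unitMod6⇔digits {0} {2} _ _ = mk⇔ (λ { (inj₁ ()) ; (inj₂ ()) }) (λ { (() , _) })
unitMod6⇔digits {1} {0} _ _ = mk⇔ (λ _ → refl , λ ()) (λ _ → inj₁ refl)
unitMod6⇔digits {1} {1} _ _ = mk⇔ (λ { (inj₁ ()) ; (inj₂ ()) }) (λ (_ , 1≢1) → contradiction refl 1≢1)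
unitMod6⇔digits {1} {2} _ _ = mk⇔ (λ _ → refl , λ ()) (λ _ → inj₂ refl)
unitMod6⇔digits {suc (suc _)} (s≤s ())
unitMod6⇔digits {_} {suc (suc (suc _))} _ (s≤s (s≤s ()))

NoRepeatedDigit : ℕ → ℕ → Set
NoRepeatedDigit m t = ∀ i → suc i < m → ¬ (digit t i ≡ digit t (suc i) × t %! i ≡ 0)

-- Since ℓ₀ = 0, the conditions for i = 0 and i = 1 force ℓ₁ = 1 and ℓ₂ ≠ 1, i.e. t ≡ 1, 5 (mod 6);
-- conversely ℓ₁ = 1 makes t %! i ≢ 0 for every i ≥ 2.
noRepeatedDigit⇔unitMod6 : ∀ {m t} → 2 ≤ m → t < m ! → NoRepeatedDigit m t ⇔ UnitMod6 t
noRepeatedDigit⇔unitMod6 {m} {t} 2≤m t< = mk⇔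
  (λ noRepeat → subst (λ r → r ≡ 1 ⊎ r ≡ 5) (sym (%6≡digits t)) (from (unitMod6⇔digits (digit≤ t 1) (digit≤ t 2)) (ℓ₁≡1 noRepeat , ℓ₂≢1 noRepeat (ℓ₁≡1 noRepeat))))
  (λ u → let (ℓ₁≡1 , ℓ₂≢1) = to (unitMod6⇔digits (digit≤ t 1) (digit≤ t 2)) (subst (λ r → r ≡ 1 ⊎ r ≡ 5) (%6≡digits t) u) in noRepeat ℓ₁≡1 ℓ₂≢1)
  where
  ℓ₁≡1 : NoRepeatedDigit m t → digit t 1 ≡ 1
  ℓ₁≡1 noRepeat with digit t 1 in eq | digit≤ t 1
  ... | 0 | _ = contradiction (trans (digit-zero t) (sym eq) , %!-zero t) (noRepeat 0 2≤m)
  ... | 1 | _ = refl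
  ... | suc (suc _) | s≤s ()
  ℓ₂≢1′ : ∀ {m′} → 2 ≤ m′ → t < m′ ! → NoRepeatedDigit m′ t → digit t 1 ≡ 1 → digit t 2 ≢ 1
  ℓ₂≢1′ {1} (s≤s ())
  ℓ₂≢1′ {2} _ t<2 _ _ ℓ₂≡1 = contradiction (trans (sym ℓ₂≡1) (cong (_% 3) (m<n⇒m/n≡0 t<2))) λ ()
  ℓ₂≢1′ {suc (suc (suc _))} _ _ noRepeat ℓ₁≡1 ℓ₂≡1 = noRepeat 1 (s≤s (s≤s (s≤s z≤n))) (trans ℓ₁≡1 (sym ℓ₂≡1) , %!-one t)
  ℓ₂≢1 : NoRepeatedDigit m t → digit t 1 ≡ 1 → digit t 2 ≢ 1
  ℓ₂≢1 = ℓ₂≢1′ 2≤m t<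
  noRepeat : digit t 1 ≡ 1 → digit t 2 ≢ 1 → NoRepeatedDigit m t
  noRepeat ℓ₁≡1 ℓ₂≢1 0 _ (ℓ₀≡ℓ₁ , _) = contradiction (trans (sym (digit-zero t)) (trans ℓ₀≡ℓ₁ ℓ₁≡1)) λ ()
  noRepeat ℓ₁≡1 ℓ₂≢1 1 _ (ℓ₁≡ℓ₂ , _) = ℓ₂≢1 (trans (sym ℓ₁≡ℓ₂) ℓ₁≡1)
  noRepeat ℓ₁≡1 ℓ₂≢1 (suc (suc i)) _ (_ , r≡0) = contradiction (trans (sym ℓ₁≡1) (trans (sym (%!-two t)) (%!≡0-antimono t {j = suc (suc i)} (s≤s (s≤s z≤n)) r≡0))) λ ()

-- The embedding ℤ → ℚ and finite sums

private
  embed : ℤ → ℚᵘ.ℚᵘ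
  embed a = ℚᵘ.mkℚᵘ a 0

  fromℚᵘ-homo₂ : ∀ {_∙ᵘ_ : ℚᵘ.ℚᵘ → ℚᵘ.ℚᵘ → ℚᵘ.ℚᵘ} {_∙_ : ℚ → ℚ → ℚ} →
    (∀ {x y u v} → x ℚᵘ.≃ y → u ℚᵘ.≃ v → (x ∙ᵘ u) ℚᵘ.≃ (y ∙ᵘ v)) →
    (∀ p q → ℚ.toℚᵘ (p ∙ q) ℚᵘ.≃ (ℚ.toℚᵘ p ∙ᵘ ℚ.toℚᵘ q)) →
    ∀ x y → ℚ.fromℚᵘ (x ∙ᵘ y) ≡ (ℚ.fromℚᵘ x ∙ ℚ.fromℚᵘ y)
  fromℚᵘ-homo₂ cong∙ homo x y = ℚP.toℚᵘ-injective (ℚᵘP.≃-trans (ℚP.toℚᵘ-fromℚᵘ _)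
    (ℚᵘP.≃-trans (cong∙ (ℚᵘP.≃-sym (ℚP.toℚᵘ-fromℚᵘ x)) (ℚᵘP.≃-sym (ℚP.toℚᵘ-fromℚᵘ y))) (ℚᵘP.≃-sym (homo _ _))))

toℚ-+ : ∀ a b → toℚ (a ℤ.+ b) ≡ toℚ a ℚ.+ toℚ b
toℚ-+ a b = trans (ℚP.fromℚᵘ-cong {embed (a ℤ.+ b)} {embed a ℚᵘ.+ embed b} (ℚᵘ.*≡* eq))
                  (fromℚᵘ-homo₂ ℚᵘP.+-cong ℚP.toℚᵘ-homo-+ (embed a) (embed b))
  where
  eq : (a ℤ.+ b) ℤ.* ℤ.+ 1 ≡ (a ℤ.* ℤ.+ 1 ℤ.+ b ℤ.* ℤ.+ 1) ℤ.* ℤ.+ 1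
  eq = cong (ℤ._* ℤ.+ 1) (sym (cong₂ ℤ._+_ (ℤP.*-identityʳ a) (ℤP.*-identityʳ b)))

toℚ-* : ∀ a b → toℚ (a ℤ.* b) ≡ toℚ a ℚ.* toℚ b
toℚ-* a b = trans (ℚP.fromℚᵘ-cong {embed (a ℤ.* b)} {embed a ℚᵘ.* embed b} (ℚᵘ.*≡* refl))
                  (fromℚᵘ-homo₂ ℚᵘP.*-cong ℚP.toℚᵘ-homo-* (embed a) (embed b))

toℚ-neg : ∀ a → toℚ (ℤ.- a) ≡ ℚ.- toℚ a
toℚ-neg a = trans (ℚP.fromℚᵘ-cong {embed (ℤ.- a)} {ℚᵘ.- embed a} (ℚᵘ.*≡* refl))
  (ℚP.toℚᵘ-injective (ℚᵘP.≃-trans (ℚP.toℚᵘ-fromℚᵘ _)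
    (ℚᵘP.≃-trans (ℚᵘP.-‿cong (ℚᵘP.≃-sym (ℚP.toℚᵘ-fromℚᵘ (embed a)))) (ℚᵘP.≃-sym (ℚP.toℚᵘ-homo‿- (toℚ a))))))

↥toℚ : ∀ a → ↥ (toℚ a) ≡ a
↥toℚ a = trans (sym (ℤP.*-identityʳ _)) (trans (cong (↥ (toℚ a) ℤ.*_) (sym (cong ℤ.+_ (ℕGCD.gcd-zeroʳ ℤ.∣ a ∣)))) (ℚP.↥-/ a 1))

↧toℚ : ∀ a → ↧ (toℚ a) ≡ ℤ.+ 1
↧toℚ a = trans (sym (ℤP.*-identityʳ _)) (trans (cong (↧ (toℚ a) ℤ.*_) (sym (cong ℤ.+_ (ℕGCD.gcd-zeroʳ ℤ.∣ a ∣)))) (ℚP.↧-/ a 1))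

toℚ-injective : ∀ {a b} → toℚ a ≡ toℚ b → a ≡ b
toℚ-injective {a} {b} eq = trans (sym (↥toℚ a)) (trans (cong ↥_ eq) (↥toℚ b))

toℚ-<⇔ : ∀ {a b} → toℚ a ℚ.< toℚ b ⇔ a ℤ.< b
toℚ-<⇔ {a} {b} = mk⇔ (λ { (*<* lt) → subst₂ ℤ._<_ (cross a b) (cross b a) lt }) (λ lt → *<* (subst₂ ℤ._<_ (sym (cross a b)) (sym (cross b a)) lt))
  where
  cross : ∀ x y → ↥ (toℚ x) ℤ.* ↧ (toℚ y) ≡ x
  cross x y = trans (cong₂ ℤ._*_ (↥toℚ x) (↧toℚ y)) (ℤP.*-identityʳ x)

sumℚ-cong : ∀ {k} {f g : Fin k → ℚ} → (∀ i → f i ≡ g i) → sumℚ f ≡ sumℚ g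
sumℚ-cong {zero} _ = refl
sumℚ-cong {suc k} f≡g = cong₂ ℚ._+_ (f≡g Fin.zero) (sumℚ-cong (f≡g ∘ Fin.suc))

sumℚ-+ : ∀ {k} (f g : Fin k → ℚ) → sumℚ (λ i → f i ℚ.+ g i) ≡ sumℚ f ℚ.+ sumℚ g
sumℚ-+ {zero} f g = refl
sumℚ-+ {suc k} f g = trans (cong (f Fin.zero ℚ.+ g Fin.zero ℚ.+_) (sumℚ-+ (f ∘ Fin.suc) (g ∘ Fin.suc)))
  (solve 4 (λ a b c d → (a :+ b) :+ (c :+ d) := (a :+ c) :+ (b :+ d)) refl (f Fin.zero) (g Fin.zero) (sumℚ (f ∘ Fin.suc)) (sumℚ (g ∘ Fin.suc)))
  where open ℚS.+-*-Solver

sumℚ-*ˡ : ∀ {k} a (f : Fin k → ℚ) → sumℚ (λ i → a ℚ.* f i) ≡ a ℚ.* sumℚ f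
sumℚ-*ˡ {zero} a f = sym (ℚP.*-zeroʳ a)
sumℚ-*ˡ {suc k} a f = trans (cong (a ℚ.* f Fin.zero ℚ.+_) (sumℚ-*ˡ a (f ∘ Fin.suc))) (sym (ℚP.*-distribˡ-+ a (f Fin.zero) _))

sumℚ-*ʳ : ∀ {k} (f : Fin k → ℚ) a → sumℚ (λ i → f i ℚ.* a) ≡ sumℚ f ℚ.* a
sumℚ-*ʳ f a = trans (sumℚ-cong (λ i → ℚP.*-comm (f i) a)) (trans (sumℚ-*ˡ a f) (ℚP.*-comm a (sumℚ f)))

sumℚ-indicator : ∀ {k} (f : Fin k → ℚ) (c : Fin k) → sumℚ (λ i → f i ℚ.* toℚ (if does (c FinP.≟ i) then ℤ.+ 1 else ℤ.+ 0)) ≡ f c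
sumℚ-indicator {suc k} f Fin.zero = trans (cong₂ ℚ._+_ (ℚP.*-identityʳ (f Fin.zero)) (trans (sumℚ-cong (λ i → ℚP.*-zeroʳ (f (Fin.suc i)))) (zeros k))) (ℚP.+-identityʳ _)
  where
  zeros : ∀ k → sumℚ {k} (λ _ → 0ℚ) ≡ 0ℚ
  zeros zero = refl
  zeros (suc k) = trans (ℚP.+-identityˡ _) (zeros k)
sumℚ-indicator {suc k} f (Fin.suc c) = trans (cong₂ ℚ._+_ (ℚP.*-zeroʳ (f Fin.zero)) (sumℚ-indicator (f ∘ Fin.suc) c)) (ℚP.+-identityˡ _)

sumℤ : ∀ {k} → (Fin k → ℤ) → ℤ
sumℤ {zero} f = ℤ.+ 0
sumℤ {suc k} f = f Fin.zero ℤ.+ sumℤ (f ∘ Fin.suc)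

sumℚ-toℚ : ∀ {k} (f : Fin k → ℤ) → sumℚ (toℚ ∘ f) ≡ toℚ (sumℤ f)
sumℚ-toℚ {zero} f = refl
sumℚ-toℚ {suc k} f = trans (cong (toℚ (f Fin.zero) ℚ.+_) (sumℚ-toℚ (f ∘ Fin.suc))) (sym (toℚ-+ (f Fin.zero) _))

ℕ→ℚ : ℕ → ℚ
ℕ→ℚ k = toℚ (ℤ.+ k)

ℕ→ℚ-+ : ∀ a b → ℕ→ℚ (a + b) ≡ ℕ→ℚ a ℚ.+ ℕ→ℚ b
ℕ→ℚ-+ a b = trans (cong toℚ (ℤP.pos-+ a b)) (toℚ-+ (ℤ.+ a) (ℤ.+ b))

ℕ→ℚ-* : ∀ a b → ℕ→ℚ (a * b) ≡ ℕ→ℚ a ℚ.* ℕ→ℚ b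
ℕ→ℚ-* a b = trans (cong toℚ (ℤP.pos-* a b)) (toℚ-* (ℤ.+ a) (ℤ.+ b))

lookup-∷ʳ-inject₁ : ∀ {A : Set} {N} (v : Vec A N) a c → lookup (v ∷ʳ a) (inject₁ c) ≡ lookup v c
lookup-∷ʳ-inject₁ (x Vec.∷ v) a Fin.zero = refl
lookup-∷ʳ-inject₁ (x Vec.∷ v) a (Fin.suc c) = lookup-∷ʳ-inject₁ v a c

lookup-∷ʳ-fromℕ : ∀ {A : Set} {N} (v : Vec A N) a → lookup (v ∷ʳ a) (fromℕ N) ≡ a
lookup-∷ʳ-fromℕ Vec.[] a = refl
lookup-∷ʳ-fromℕ (x Vec.∷ v) a = lookup-∷ʳ-fromℕ v a

Fin-∷ʳ-induction : ∀ {N} {P : Fin (suc N) → Set} → (∀ c → P (inject₁ c)) → P (fromℕ N) → ∀ j → P j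
Fin-∷ʳ-induction {zero} _ last Fin.zero = last
Fin-∷ʳ-induction {suc N} init _ Fin.zero = init Fin.zero
Fin-∷ʳ-induction {suc N} {P} init last (Fin.suc j) = Fin-∷ʳ-induction {P = P ∘ Fin.suc} (init ∘ Fin.suc) last j

∷ʳ-ext : ∀ {A : Set} {N} (x : Vec A (suc N)) (v : Vec A N) a →
  (∀ c → lookup x (inject₁ c) ≡ lookup v c) → lookup x (fromℕ N) ≡ a → x ≡ v ∷ʳ a
∷ʳ-ext x v a init≡ last≡ with Vec.initLast x
... | ys , y , refl = cong₂ _∷ʳ_
  (trans (sym (tabulate∘lookup ys)) (trans (tabulate-cong (λ c → trans (sym (lookup-∷ʳ-inject₁ ys y c)) (init≡ c))) (tabulate∘lookup v)))
  (trans (sym (lookup-∷ʳ-fromℕ ys y)) last≡)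

sumℤ-neg : ∀ {k} (f : Fin k → ℤ) → sumℤ (λ c → ℤ.- f c) ≡ ℤ.- sumℤ f
sumℤ-neg {zero} f = refl
sumℤ-neg {suc k} f = trans (cong (λ s → ℤ.- f Fin.zero ℤ.+ s) (sumℤ-neg (f ∘ Fin.suc))) (sym (ℤP.neg-distrib-+ (f Fin.zero) _))

sumℤ-cong : ∀ {k} {f g : Fin k → ℤ} → (∀ i → f i ≡ g i) → sumℤ f ≡ sumℤ g
sumℤ-cong {zero} _ = refl
sumℤ-cong {suc k} f≡g = cong₂ ℤ._+_ (f≡g Fin.zero) (sumℤ-cong (f≡g ∘ Fin.suc))

∀-Fin-reverse⇔ : ∀ {n} {P : ℕ → Set} → (∀ (c : Fin n) → P (n ∸ suc (toℕ c))) ⇔ (∀ j → j < n → P j)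
∀-Fin-reverse⇔ {n} {P} = mk⇔
  (λ h j j<n → subst P (reverse-involutive j<n) (h (Fin.fromℕ< (reverse< j<n))))
  (λ h c → h (n ∸ suc (toℕ c)) (reverse< (FinP.toℕ<n c)))
  where
  reverse< : ∀ {j} → j < n → n ∸ suc j < n
  reverse< j<n = ∸-monoʳ-< (s≤s z≤n) j<n
  reverse-involutive : ∀ {j} (j<n : j < n) → n ∸ suc (toℕ (Fin.fromℕ< (reverse< j<n))) ≡ j
  reverse-involutive {j} j<n = trans (cong (λ k → n ∸ suc k) (FinP.toℕ-fromℕ< (reverse< j<n))) (trans (cong (n ∸_) (sym (+-∸-assoc 1 j<n))) (m∸[m∸n]≡n (<⇒≤ j<n)))

-- Lattice points in the open parallelepiped of Δ_(1,q)

multiple+offset-≮ : ∀ (F : ℕ) {u v} w → ℤ.+ 0 ℤ.≤ ℤ.+ F ℤ.* u ℤ.+ w → ℤ.+ F ℤ.* v ℤ.+ w ℤ.< ℤ.+ F → ¬ u ℤ.< v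
multiple+offset-≮ F {u} {v} w 0≤ <F u<v = ℤP.<-irrefl refl (ℤP.≤-<-trans F≤ <F)
  where
  open ℤP.≤-Reasoning
  F≤ : ℤ.+ F ℤ.≤ ℤ.+ F ℤ.* v ℤ.+ w
  F≤ = begin
    ℤ.+ F                              ≡⟨ ℤP.+-identityʳ (ℤ.+ F) ⟨
    ℤ.+ F ℤ.+ ℤ.+ 0                    ≤⟨ ℤP.+-monoʳ-≤ (ℤ.+ F) 0≤ ⟩
    ℤ.+ F ℤ.+ (ℤ.+ F ℤ.* u ℤ.+ w)      ≡⟨ ℤP.+-assoc (ℤ.+ F) (ℤ.+ F ℤ.* u) w ⟨
    ℤ.+ F ℤ.+ ℤ.+ F ℤ.* u ℤ.+ w        ≡⟨ cong (ℤ._+ w) (ℤP.*-suc (ℤ.+ F) u) ⟨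
    ℤ.+ F ℤ.* ℤ.suc u ℤ.+ w            ≤⟨ ℤP.+-monoˡ-≤ w (ℤP.*-monoˡ-≤-nonNeg (ℤ.+ F) (ℤP.i<j⇒suc[i]≤j u<v)) ⟩
    ℤ.+ F ℤ.* v ℤ.+ w                  ∎

multiple+offset-unique : ∀ (F : ℕ) {u v} w → ℤ.+ 0 ℤ.≤ ℤ.+ F ℤ.* u ℤ.+ w → ℤ.+ F ℤ.* u ℤ.+ w ℤ.< ℤ.+ F →
  ℤ.+ 0 ℤ.≤ ℤ.+ F ℤ.* v ℤ.+ w → ℤ.+ F ℤ.* v ℤ.+ w ℤ.< ℤ.+ F → u ≡ v
multiple+offset-unique F {u} {v} w 0≤u u<F 0≤v v<F with ℤP.<-cmp u v
... | tri< u<v _ _ = contradiction u<v (multiple+offset-≮ F w 0≤u v<F)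
... | tri≈ _ u≡v _ = u≡v
... | tri> _ _ v<u = contradiction v<u (multiple+offset-≮ F w 0≤v u<F)

module OpenParallelepiped (n : ℕ) (q : ℕ → ℕ) (F : ℕ) .{{F≢0 : NonZero F}}
       (volume : ℤ.+ F ≡ ℤ.+ 1 ℤ.+ sumℤ (λ (c : Fin n) → ℤ.+ q (suc (toℕ c)))) where

  weight : Fin n → ℕ
  weight c = q (suc (toℕ c))

  rem quo : ℕ → Fin n → ℕ
  rem t c = t * weight c % F
  quo t c = t * weight c / F

  height : ℕ → ℤ
  height t = ℤ.+ t ℤ.- sumℤ (λ c → ℤ.+ quo t c)

  coordinates : ℕ → Vec ℤ n
  coordinates t = tabulate (λ c → ℤ.- ℤ.+ quo t c)

  point : ℕ → Vec ℤ (suc n)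
  point t = coordinates t ∷ʳ height t

  IsInteriorIndex : ℕ → Set
  IsInteriorIndex t = 1 ≤ t × t < F × ∀ c → rem t c ≢ 0

  private
    V = simplex1q n q
    Φ = ℕ→ℚ F

  Barycentric : Vec ℤ (suc n) → (Fin (suc n) → ℚ) → Fin (suc n) → Set
  Barycentric x lam j = toℚ (lookup x j) ≡ sumℚ (λ i → lam i ℚ.* toℚ (lookup (liftPt (V i)) j))

  barycentric-inject₁ : ∀ lam c → sumℚ (λ i → lam i ℚ.* toℚ (lookup (liftPt (V i)) (inject₁ c))) ≡ lam Fin.zero ℚ.* ℚ.- ℕ→ℚ (weight c) ℚ.+ lam (Fin.suc c)
  barycentric-inject₁ lam c = cong₂ ℚ._+_
    (cong (λ z → lam Fin.zero ℚ.* z) (trans (cong toℚ (trans (lookup-∷ʳ-inject₁ (V Fin.zero) (ℤ.+ 1) c) (lookup∘tabulate _ c))) (toℚ-neg (ℤ.+ weight c))))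
    (trans (sumℚ-cong (λ i → cong (λ z → lam (Fin.suc i) ℚ.* toℚ z) (trans (lookup-∷ʳ-inject₁ (V (Fin.suc i)) (ℤ.+ 1) c) (lookup∘tabulate _ c))))
           (sumℚ-indicator (lam ∘ Fin.suc) c))

  barycentric-fromℕ : ∀ lam → sumℚ (λ i → lam i ℚ.* toℚ (lookup (liftPt (V i)) (fromℕ n))) ≡ sumℚ lam
  barycentric-fromℕ lam = sumℚ-cong (λ i → trans (cong (λ z → lam i ℚ.* toℚ z) (lookup-∷ʳ-fromℕ (V i) (ℤ.+ 1))) (ℚP.*-identityʳ (lam i)))

  volumeℚ : Φ ≡ 1ℚ ℚ.+ sumℚ (ℕ→ℚ ∘ weight)
  volumeℚ = trans (cong toℚ volume) (trans (toℚ-+ (ℤ.+ 1) (sumℤ (λ c → ℤ.+ weight c))) (cong (1ℚ ℚ.+_) (sym (sumℚ-toℚ (λ c → ℤ.+ weight c)))))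

  division : ∀ t c → ℕ→ℚ t ℚ.* ℕ→ℚ (weight c) ≡ ℕ→ℚ (rem t c) ℚ.+ ℕ→ℚ (quo t c) ℚ.* Φ
  division t c = begin
    ℕ→ℚ t ℚ.* ℕ→ℚ (weight c)                   ≡⟨ ℕ→ℚ-* t (weight c) ⟨
    ℕ→ℚ (t * weight c)                         ≡⟨ cong ℕ→ℚ (m≡m%n+[m/n]*n (t * weight c) F) ⟩
    ℕ→ℚ (rem t c + quo t c * F)                ≡⟨ ℕ→ℚ-+ (rem t c) _ ⟩
    ℕ→ℚ (rem t c) ℚ.+ ℕ→ℚ (quo t c * F)        ≡⟨ cong (ℕ→ℚ (rem t c) ℚ.+_) (ℕ→ℚ-* (quo t c) F) ⟩
    ℕ→ℚ (rem t c) ℚ.+ ℕ→ℚ (quo t c) ℚ.* Φ      ∎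
    where open ≡-Reasoning

  toℚ-height : ∀ t → toℚ (height t) ≡ ℕ→ℚ t ℚ.- sumℚ (ℕ→ℚ ∘ quo t)
  toℚ-height t = trans (toℚ-+ (ℤ.+ t) (ℤ.- sumℤ (λ c → ℤ.+ quo t c))) (cong (ℕ→ℚ t ℚ.+_) (trans (toℚ-neg (sumℤ (λ c → ℤ.+ quo t c))) (cong ℚ.-_ (sym (sumℚ-toℚ (λ c → ℤ.+ quo t c))))))

  height-ℚ : ∀ t → Φ ℚ.* toℚ (height t) ≡ ℕ→ℚ t ℚ.+ sumℚ (ℕ→ℚ ∘ rem t)
  height-ℚ t = begin
    Φ ℚ.* toℚ (height t)                   ≡⟨ cong (Φ ℚ.*_) (toℚ-height t) ⟩
    Φ ℚ.* (τ ℚ.- D)                        ≡⟨ solve 3 (λ f x y → f :* (x :- y) := f :* x :- y :* f) refl Φ τ D ⟩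
    Φ ℚ.* τ ℚ.- D ℚ.* Φ                    ≡⟨ cong (λ f → f ℚ.* τ ℚ.- D ℚ.* Φ) volumeℚ ⟩
    (1ℚ ℚ.+ K) ℚ.* τ ℚ.- D ℚ.* Φ           ≡⟨ solve 4 (λ x k y f → (con 1ℚ :+ k) :* x :- y :* f := x :+ (x :* k :- y :* f)) refl τ K D Φ ⟩
    τ ℚ.+ (τ ℚ.* K ℚ.- D ℚ.* Φ)            ≡⟨ cong (λ s → τ ℚ.+ (s ℚ.- D ℚ.* Φ)) weightedSum ⟨
    τ ℚ.+ (R ℚ.+ D ℚ.* Φ ℚ.- D ℚ.* Φ)      ≡⟨ solve 3 (λ x r e → x :+ (r :+ e :- e) := x :+ r) refl τ R (D ℚ.* Φ) ⟩
    τ ℚ.+ R                                ∎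
    where
    open ≡-Reasoning
    open ℚS.+-*-Solver
    τ = ℕ→ℚ t
    R = sumℚ (ℕ→ℚ ∘ rem t)
    D = sumℚ (ℕ→ℚ ∘ quo t)
    K = sumℚ (ℕ→ℚ ∘ weight)
    weightedSum : R ℚ.+ D ℚ.* Φ ≡ τ ℚ.* K
    weightedSum = begin
      R ℚ.+ D ℚ.* Φ                                                ≡⟨ cong (R ℚ.+_) (sumℚ-*ʳ (ℕ→ℚ ∘ quo t) Φ) ⟨
      R ℚ.+ sumℚ (λ c → ℕ→ℚ (quo t c) ℚ.* Φ)                       ≡⟨ sumℚ-+ (ℕ→ℚ ∘ rem t) _ ⟨
      sumℚ (λ c → ℕ→ℚ (rem t c) ℚ.+ ℕ→ℚ (quo t c) ℚ.* Φ)           ≡⟨ sumℚ-cong (λ c → division t c) ⟨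
      sumℚ (λ c → τ ℚ.* ℕ→ℚ (weight c))                            ≡⟨ sumℚ-*ˡ τ (ℕ→ℚ ∘ weight) ⟩
      τ ℚ.* K                                                      ∎

  private
    Φ>0 : 0ℚ ℚ.< Φ
    Φ>0 = from toℚ-<⇔ (+<+ (>-nonZero⁻¹ F))
    instance
      Φ-positive : ℚ.Positive Φ
      Φ-positive = ℚ.positive Φ>0
      Φ-nonZero : ℚ.NonZero Φ
      Φ-nonZero = ℚP.pos⇒nonZero Φ
    φ = ℚ.1/ Φ
    instance
      φ-positive : ℚ.Positive φ
      φ-positive = ℚP.1/pos⇒pos Φ
    Φφ≡1 : Φ ℚ.* φ ≡ 1ℚ
    Φφ≡1 = ℚP.*-inverseʳ Φ

  fraction-bounds : ∀ {a} → 0 < a → a < F → 0ℚ ℚ.< ℕ→ℚ a ℚ.* φ × ℕ→ℚ a ℚ.* φ ℚ.< 1ℚ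
  fraction-bounds {a} 0<a a<F =
    subst (ℚ._< ℕ→ℚ a ℚ.* φ) (ℚP.*-zeroˡ φ) (ℚP.*-monoˡ-<-pos φ (from toℚ-<⇔ (+<+ 0<a))) ,
    subst (ℕ→ℚ a ℚ.* φ ℚ.<_) Φφ≡1 (ℚP.*-monoˡ-<-pos φ (from toℚ-<⇔ (+<+ a<F)))

  coefficients : ℕ → Fin (suc n) → ℚ
  coefficients t Fin.zero = ℕ→ℚ t ℚ.* φ
  coefficients t (Fin.suc c) = ℕ→ℚ (rem t c) ℚ.* φ

  barycentric-point : ∀ t → ∀ j → Barycentric (point t) (coefficients t) j
  barycentric-point t = Fin-∷ʳ-induction coordinate last
    where
    open ≡-Reasoning
    open ℚS.+-*-Solver
    τ = ℕ→ℚ t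
    coordinate : ∀ c → Barycentric (point t) (coefficients t) (inject₁ c)
    coordinate c = begin
      toℚ (lookup (point t) (inject₁ c))                     ≡⟨ cong toℚ (trans (lookup-∷ʳ-inject₁ (coordinates t) (height t) c) (lookup∘tabulate (λ c → ℤ.- ℤ.+ quo t c) c)) ⟩
      toℚ (ℤ.- ℤ.+ quo t c)                                  ≡⟨ toℚ-neg (ℤ.+ quo t c) ⟩
      ℚ.- δ                                                  ≡⟨ solve 1 (λ d → :- d := :- d :* con 1ℚ) refl δ ⟩
      ℚ.- δ ℚ.* 1ℚ                                           ≡⟨ cong (λ u → ℚ.- δ ℚ.* u) Φφ≡1 ⟨
      ℚ.- δ ℚ.* (Φ ℚ.* φ)                                    ≡⟨ solve 4 (λ r d f p → :- d :* (f :* p) := r :* p :- (r :+ d :* f) :* p) refl ρ δ Φ φ ⟩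
      ρ ℚ.* φ ℚ.- (ρ ℚ.+ δ ℚ.* Φ) ℚ.* φ                      ≡⟨ cong (λ u → ρ ℚ.* φ ℚ.- u ℚ.* φ) (division t c) ⟨
      ρ ℚ.* φ ℚ.- τ ℚ.* κ ℚ.* φ                              ≡⟨ solve 4 (λ r x k p → r :* p :- x :* k :* p := x :* p :* (:- k) :+ r :* p) refl ρ τ κ φ ⟩
      τ ℚ.* φ ℚ.* ℚ.- κ ℚ.+ ρ ℚ.* φ                          ≡⟨ barycentric-inject₁ (coefficients t) c ⟨
      sumℚ (λ i → coefficients t i ℚ.* toℚ (lookup (liftPt (V i)) (inject₁ c))) ∎
      where
      ρ = ℕ→ℚ (rem t c)
      δ = ℕ→ℚ (quo t c)
      κ = ℕ→ℚ (weight c)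
    last : Barycentric (point t) (coefficients t) (fromℕ n)
    last = begin
      toℚ (lookup (point t) (fromℕ n))                       ≡⟨ cong toℚ (lookup-∷ʳ-fromℕ (coordinates t) (height t)) ⟩
      toℚ (height t)                                         ≡⟨ solve 3 (λ h f p → h := (f :* h) :* p :+ h :* (con 1ℚ :- f :* p)) refl (toℚ (height t)) Φ φ ⟩
      (Φ ℚ.* toℚ (height t)) ℚ.* φ ℚ.+ toℚ (height t) ℚ.* (1ℚ ℚ.- Φ ℚ.* φ)
        ≡⟨ cong₂ (λ u v → u ℚ.* φ ℚ.+ toℚ (height t) ℚ.* (1ℚ ℚ.- v)) (height-ℚ t) Φφ≡1 ⟩
      (τ ℚ.+ sumℚ (ℕ→ℚ ∘ rem t)) ℚ.* φ ℚ.+ toℚ (height t) ℚ.* (1ℚ ℚ.- 1ℚ)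
        ≡⟨ solve 4 (λ x s p h → (x :+ s) :* p :+ h :* (con 1ℚ :- con 1ℚ) := x :* p :+ s :* p) refl τ (sumℚ (ℕ→ℚ ∘ rem t)) φ (toℚ (height t)) ⟩
      τ ℚ.* φ ℚ.+ sumℚ (ℕ→ℚ ∘ rem t) ℚ.* φ                   ≡⟨ cong (τ ℚ.* φ ℚ.+_) (sumℚ-*ʳ (ℕ→ℚ ∘ rem t) φ) ⟨
      sumℚ (coefficients t)                                  ≡⟨ barycentric-fromℕ (coefficients t) ⟨
      sumℚ (λ i → coefficients t i ℚ.* toℚ (lookup (liftPt (V i)) (fromℕ n))) ∎

  inOpenPar-point : ∀ {t} → IsInteriorIndex t → InOpenPar V (point t)
  inOpenPar-point {t} (1≤t , t<F , rem≢0) = coefficients t , bounds , barycentric-point t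
    where
    bounds : ∀ i → 0ℚ ℚ.< coefficients t i × coefficients t i ℚ.< 1ℚ
    bounds Fin.zero = fraction-bounds 1≤t t<F
    bounds (Fin.suc c) = fraction-bounds (n≢0⇒n>0 (rem≢0 c)) (m%n<n (t * weight c) F)

  -- Reading off t: the barycentric coordinate of the apex is λ₀ = t / F.
  index : Vec ℤ (suc n) → ℤ
  index x = lookup x (fromℕ n) ℤ.- sumℤ (λ c → lookup x (inject₁ c))

  index-point : ∀ t → index (point t) ≡ ℤ.+ t
  index-point t = begin
    index (point t)                          ≡⟨ cong₂ ℤ._-_ (lookup-∷ʳ-fromℕ (coordinates t) (height t)) (sumℤ-cong coordinate) ⟩
    height t ℤ.- sumℤ (λ c → ℤ.- ℤ.+ quo t c) ≡⟨ cong (λ s → height t ℤ.- s) (sumℤ-neg (λ c → ℤ.+ quo t c)) ⟩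
    height t ℤ.- ℤ.- S                       ≡⟨ solve 2 (λ x s → (x :- s) :- (:- s) := x) refl (ℤ.+ t) S ⟩
    ℤ.+ t                                    ∎
    where
    open ≡-Reasoning
    open ℤS.+-*-Solver
    S = sumℤ (λ c → ℤ.+ quo t c)
    coordinate : ∀ c → lookup (point t) (inject₁ c) ≡ ℤ.- ℤ.+ quo t c
    coordinate c = trans (lookup-∷ʳ-inject₁ (coordinates t) (height t) c) (lookup∘tabulate _ c)

  point-injective : ∀ {t t′} → point t ≡ point t′ → t ≡ t′
  point-injective {t} {t′} eq = ℤP.+-injective (trans (sym (index-point t)) (trans (cong index eq) (index-point t′)))

  scaled-bounds : ∀ {l w} → l ℚ.* Φ ≡ toℚ w → 0ℚ ℚ.< l → l ℚ.< 1ℚ → ℤ.+ 0 ℤ.< w × w ℤ.< ℤ.+ F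
  scaled-bounds eq 0<l l<1 =
    to toℚ-<⇔ (subst₂ ℚ._<_ (ℚP.*-zeroˡ Φ) eq (ℚP.*-monoˡ-<-pos Φ 0<l)) ,
    to toℚ-<⇔ (subst₂ ℚ._<_ eq (ℚP.*-identityˡ Φ) (ℚP.*-monoˡ-<-pos Φ l<1))

  module _ {x : Vec ℤ (suc n)} {lam : Fin (suc n) → ℚ} (bary : ∀ j → Barycentric x lam j) where
    private
      xc : Fin n → ℤ
      xc c = lookup x (inject₁ c)
      κ : Fin n → ℚ
      κ c = ℕ→ℚ (weight c)

    coefficient-suc : ∀ c → lam (Fin.suc c) ≡ toℚ (xc c) ℚ.+ lam Fin.zero ℚ.* κ c
    coefficient-suc c = begin
      lam (Fin.suc c)                                                         ≡⟨ solve 3 (λ l l₀ k → l := (l₀ :* (:- k) :+ l) :+ l₀ :* k) refl (lam (Fin.suc c)) (lam Fin.zero) (κ c) ⟩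
      (lam Fin.zero ℚ.* ℚ.- κ c ℚ.+ lam (Fin.suc c)) ℚ.+ lam Fin.zero ℚ.* κ c ≡⟨ cong (ℚ._+ lam Fin.zero ℚ.* κ c) (trans (bary (inject₁ c)) (barycentric-inject₁ lam c)) ⟨
      toℚ (xc c) ℚ.+ lam Fin.zero ℚ.* κ c                                    ∎
      where
      open ≡-Reasoning
      open ℚS.+-*-Solver

    coefficient-zero : lam Fin.zero ℚ.* Φ ≡ toℚ (index x)
    coefficient-zero = begin
      lam Fin.zero ℚ.* Φ                                      ≡⟨ cong (lam Fin.zero ℚ.*_) volumeℚ ⟩
      lam Fin.zero ℚ.* (1ℚ ℚ.+ sumℚ κ)                         ≡⟨ solve 3 (λ l s k → l :* (con 1ℚ :+ k) := (l :+ (s :+ l :* k)) :- s) refl (lam Fin.zero) X (sumℚ κ) ⟩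
      (lam Fin.zero ℚ.+ (X ℚ.+ lam Fin.zero ℚ.* sumℚ κ)) ℚ.- X ≡⟨ cong (λ s → (lam Fin.zero ℚ.+ s) ℚ.- X) lamSum ⟨
      sumℚ lam ℚ.- X                                          ≡⟨ cong₂ ℚ._-_ (trans (bary (fromℕ n)) (barycentric-fromℕ lam)) (sym (sumℚ-toℚ xc)) ⟨
      toℚ (lookup x (fromℕ n)) ℚ.- toℚ (sumℤ xc)               ≡⟨ trans (toℚ-+ (lookup x (fromℕ n)) (ℤ.- sumℤ xc)) (cong (toℚ (lookup x (fromℕ n)) ℚ.+_) (toℚ-neg (sumℤ xc))) ⟨
      toℚ (index x)                                           ∎
      where
      open ≡-Reasoning
      open ℚS.+-*-Solver
      X = sumℚ (toℚ ∘ xc)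
      lamSum : sumℚ (lam ∘ Fin.suc) ≡ X ℚ.+ lam Fin.zero ℚ.* sumℚ κ
      lamSum = trans (sumℚ-cong coefficient-suc) (trans (sumℚ-+ (toℚ ∘ xc) _) (cong (X ℚ.+_) (sumℚ-*ˡ (lam Fin.zero) κ)))

    module _ {t} (index≡t : index x ≡ ℤ.+ t) where
      private
        W : Fin n → ℤ
        W c = ℤ.+ F ℤ.* xc c ℤ.+ ℤ.+ (t * weight c)

      coefficient-suc-scaled : ∀ c → lam (Fin.suc c) ℚ.* Φ ≡ toℚ (W c)
      coefficient-suc-scaled c = begin
        lam (Fin.suc c) ℚ.* Φ                                   ≡⟨ cong (ℚ._* Φ) (coefficient-suc c) ⟩
        (toℚ (xc c) ℚ.+ lam Fin.zero ℚ.* κ c) ℚ.* Φ              ≡⟨ solve 4 (λ y l k f → (y :+ l :* k) :* f := f :* y :+ k :* (l :* f)) refl (toℚ (xc c)) (lam Fin.zero) (κ c) Φ ⟩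
        Φ ℚ.* toℚ (xc c) ℚ.+ κ c ℚ.* (lam Fin.zero ℚ.* Φ)        ≡⟨ cong (λ u → Φ ℚ.* toℚ (xc c) ℚ.+ κ c ℚ.* u) (trans coefficient-zero (cong toℚ index≡t)) ⟩
        Φ ℚ.* toℚ (xc c) ℚ.+ κ c ℚ.* ℕ→ℚ t                       ≡⟨ cong₂ ℚ._+_ (toℚ-* (ℤ.+ F) (xc c)) (trans (ℕ→ℚ-* t (weight c)) (ℚP.*-comm (ℕ→ℚ t) (κ c))) ⟨
        toℚ (ℤ.+ F ℤ.* xc c) ℚ.+ ℕ→ℚ (t * weight c)              ≡⟨ toℚ-+ (ℤ.+ F ℤ.* xc c) _ ⟨
        toℚ (W c)                                               ∎
        where
        open ≡-Reasoning
        open ℚS.+-*-Solver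

      remainder : ∀ c → ℤ.+ F ℤ.* (ℤ.- ℤ.+ quo t c) ℤ.+ ℤ.+ (t * weight c) ≡ ℤ.+ rem t c
      remainder c = begin
        ℤ.+ F ℤ.* (ℤ.- ℤ.+ quo t c) ℤ.+ ℤ.+ (t * weight c)                  ≡⟨ cong (λ u → ℤ.+ F ℤ.* (ℤ.- ℤ.+ quo t c) ℤ.+ ℤ.+ u) (m≡m%n+[m/n]*n (t * weight c) F) ⟩
        ℤ.+ F ℤ.* (ℤ.- ℤ.+ quo t c) ℤ.+ ℤ.+ (rem t c + quo t c * F)         ≡⟨ cong (λ u → ℤ.+ F ℤ.* (ℤ.- ℤ.+ quo t c) ℤ.+ u) (trans (ℤP.pos-+ (rem t c) _) (cong (λ u → ℤ.+ rem t c ℤ.+ u) (ℤP.pos-* (quo t c) F))) ⟩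
        ℤ.+ F ℤ.* (ℤ.- ℤ.+ quo t c) ℤ.+ (ℤ.+ rem t c ℤ.+ ℤ.+ quo t c ℤ.* ℤ.+ F) ≡⟨ solve 3 (λ f d r → f :* (:- d) :+ (r :+ d :* f) := r) refl (ℤ.+ F) (ℤ.+ quo t c) (ℤ.+ rem t c) ⟩
        ℤ.+ rem t c                                                          ∎
        where
        open ≡-Reasoning
        open ℤS.+-*-Solver

      module _ (bounds : ∀ i → 0ℚ ℚ.< lam i × lam i ℚ.< 1ℚ) where
        private
          Wbounds : ∀ c → ℤ.+ 0 ℤ.< W c × W c ℤ.< ℤ.+ F
          Wbounds c = scaled-bounds (coefficient-suc-scaled c) (proj₁ (bounds (Fin.suc c))) (proj₂ (bounds (Fin.suc c)))

        -- λ_c · F = F·x_c + t·q_c lies strictly between 0 and F, which pins x_c = −⌊t q_c / F⌋.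
        coordinate≡ : ∀ c → xc c ≡ ℤ.- ℤ.+ quo t c
        coordinate≡ c = multiple+offset-unique F (ℤ.+ (t * weight c)) (ℤP.<⇒≤ (proj₁ (Wbounds c))) (proj₂ (Wbounds c))
          (subst (ℤ.+ 0 ℤ.≤_) (sym (remainder c)) (+≤+ z≤n)) (subst (ℤ._< ℤ.+ F) (sym (remainder c)) (+<+ (m%n<n (t * weight c) F)))

        rem≢0 : ∀ c → rem t c ≢ 0
        rem≢0 c rem≡0 = ℤP.<-irrefl refl (subst (ℤ.+ 0 ℤ.<_) W≡0 (proj₁ (Wbounds c)))
          where
          W≡0 : W c ≡ ℤ.+ 0
          W≡0 = trans (cong (λ u → ℤ.+ F ℤ.* u ℤ.+ ℤ.+ (t * weight c)) (coordinate≡ c)) (trans (remainder c) (cong ℤ.+_ rem≡0))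

        ≡point : x ≡ point t
        ≡point = ∷ʳ-ext x (coordinates t) (height t) (λ c → trans (coordinate≡ c) (sym (lookup∘tabulate _ c))) (begin
          lookup x (fromℕ n)          ≡⟨ solve 2 (λ l s → l := (l :- s) :+ s) refl (lookup x (fromℕ n)) (sumℤ xc) ⟩
          index x ℤ.+ sumℤ xc         ≡⟨ cong₂ ℤ._+_ index≡t (trans (sumℤ-cong coordinate≡) (sumℤ-neg (λ c → ℤ.+ quo t c))) ⟩
          height t                    ∎)
          where
          open ≡-Reasoning
          open ℤS.+-*-Solver

  inOpenPar⇒point : ∀ {x} → InOpenPar V x → Σ ℕ λ t → IsInteriorIndex t × x ≡ point t
  inOpenPar⇒point {x} (lam , bounds , bary) =
    fromIndex (index x) refl (scaled-bounds (coefficient-zero {x} {lam} bary) (proj₁ (bounds Fin.zero)) (proj₂ (bounds Fin.zero)))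
    where
    fromIndex : ∀ z → index x ≡ z → ℤ.+ 0 ℤ.< z × z ℤ.< ℤ.+ F → Σ ℕ λ t → IsInteriorIndex t × x ≡ point t
    fromIndex (ℤ.+ t) index≡t (+<+ 1≤t , +<+ t<F) = t , (1≤t , t<F , rem≢0 {x} {lam} bary index≡t bounds) , ≡point {x} {lam} bary index≡t bounds

  inOpenPar⇔ : ∀ x → InOpenPar V x ⇔ (Σ ℕ λ t → IsInteriorIndex t × x ≡ point t)
  inOpenPar⇔ x = mk⇔ inOpenPar⇒point (λ (t , interior , x≡) → subst (InOpenPar V) (sym x≡) (inOpenPar-point interior))

  Φ*-cancel : ∀ {a b} → Φ ℚ.* a ≡ Φ ℚ.* b → a ≡ b
  Φ*-cancel {a} {b} eq = begin
    a                  ≡⟨ ℚP.*-identityˡ a ⟨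
    1ℚ ℚ.* a           ≡⟨ cong (ℚ._* a) (ℚP.*-inverseˡ Φ) ⟨
    φ ℚ.* Φ ℚ.* a      ≡⟨ ℚP.*-assoc φ Φ a ⟩
    φ ℚ.* (Φ ℚ.* a)    ≡⟨ cong (φ ℚ.*_) eq ⟩
    φ ℚ.* (Φ ℚ.* b)    ≡⟨ ℚP.*-assoc φ Φ b ⟨
    φ ℚ.* Φ ℚ.* b      ≡⟨ cong (ℚ._* b) (ℚP.*-inverseˡ Φ) ⟩
    1ℚ ℚ.* b           ≡⟨ ℚP.*-identityˡ b ⟩
    b                  ∎
    where open ≡-Reasoning

  height≡ : ∀ t h → ℕ→ℚ t ℚ.+ sumℚ (ℕ→ℚ ∘ rem t) ≡ Φ ℚ.* ℕ→ℚ h → height t ≡ ℤ.+ h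
  height≡ t h eq = toℚ-injective (Φ*-cancel (trans (height-ℚ t) eq))

-- Telescoping sums and residues of differences

sumBelow : (ℕ → ℕ) → ℕ → ℕ
sumBelow f zero = 0
sumBelow f (suc k) = f k + sumBelow f k

telescope : ∀ (r a e : ℕ → ℕ) k → (∀ j → j < k → r j + a (suc j) ≡ a j + e j) → sumBelow r k + a k ≡ a 0 + sumBelow e k
telescope r a e zero _ = sym (+-identityʳ (a 0))
telescope r a e (suc k) step = begin
  r k + sumBelow r k + a (suc k)      ≡⟨ solve 3 (λ x s y → x :+ s :+ y := s :+ (x :+ y)) refl (r k) (sumBelow r k) (a (suc k)) ⟩
  sumBelow r k + (r k + a (suc k))    ≡⟨ cong (sumBelow r k +_) (step k ≤-refl) ⟩
  sumBelow r k + (a k + e k)          ≡⟨ +-assoc (sumBelow r k) (a k) (e k) ⟨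
  sumBelow r k + a k + e k            ≡⟨ cong (_+ e k) (telescope r a e k (λ j j<k → step j (m<n⇒m<1+n j<k))) ⟩
  a 0 + sumBelow e k + e k            ≡⟨ solve 3 (λ x s y → x :+ s :+ y := x :+ (y :+ s)) refl (a 0) (sumBelow e k) (e k) ⟩
  a 0 + (e k + sumBelow e k)          ∎
  where
  open ≡-Reasoning
  open +-*-Solver

sumBelow-*ˡ : ∀ c f k → sumBelow (λ j → c * f j) k ≡ c * sumBelow f k
sumBelow-*ˡ c f zero = sym (*-zeroʳ c)
sumBelow-*ˡ c f (suc k) = trans (cong (c * f k +_) (sumBelow-*ˡ c f k)) (sym (*-distribˡ-+ c (f k) _))

count≡sumBelow : ∀ {P : ℕ → Set} (P? : Decidable P) k → count P? k ≡ sumBelow (λ j → if does (P? j) then 1 else 0) k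
count≡sumBelow P? zero = refl
count≡sumBelow P? (suc k) = trans (count-suc P? k) (trans (+-comm (count P? k) _) (cong ((if does (P? k) then 1 else 0) +_) (count≡sumBelow P? k)))

%-two-cases : ∀ {F} .{{_ : NonZero F}} {x} → x < F + F → x ≡ x % F ⊎ x ≡ x % F + F
%-two-cases {F} {x} x<2F with x <? F
... | yes x<F = inj₁ (sym (m<n⇒m%n≡m x<F))
... | no x≮F = inj₂ (begin
  x                      ≡⟨ m∸n+n≡m F≤x ⟨
  x ∸ F + F              ≡⟨ cong (_+ F) (m<n⇒m%n≡m (+-cancelʳ-< F (x ∸ F) F (subst (_< F + F) (sym (m∸n+n≡m F≤x)) x<2F))) ⟨
  (x ∸ F) % F + F        ≡⟨ cong (_+ F) ([m+n]%n≡m%n (x ∸ F) F) ⟨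
  (x ∸ F + F) % F + F    ≡⟨ cong (λ y → y % F + F) (m∸n+n≡m F≤x) ⟩
  x % F + F              ∎)
  where
  open ≡-Reasoning
  F≤x = ≮⇒≥ x≮F

-- The hypothesis (r + b) % F ≡ a says that r is the residue of a − b modulo F.
residue-of-difference : ∀ {F} .{{_ : NonZero F}} {r a b} → r < F → b < F → (r + b) % F ≡ a →
  r + b ≡ a + F * (if does (a <? b) then 1 else 0)
residue-of-difference {F} {r} {a} {b} r<F b<F r+b≡a with %-two-cases {F} {r + b} (+-mono-< r<F b<F)
... | inj₁ eq = begin
  r + b                                      ≡⟨ trans eq r+b≡a ⟩
  a                                          ≡⟨ trans (cong (a +_) (*-zeroʳ F)) (+-identityʳ a) ⟨
  a + F * 0                                  ≡⟨ cong (λ c → a + F * (if c then 1 else 0)) (dec-false (a <? b) a≮b) ⟨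
  a + F * (if does (a <? b) then 1 else 0)   ∎
  where
  open ≡-Reasoning
  a≮b : ¬ a < b
  a≮b a<b = <⇒≱ a<b (≤-trans (m≤n+m b r) (≤-reflexive (trans eq r+b≡a)))
... | inj₂ eq = begin
  r + b                                      ≡⟨ trans eq (cong (_+ F) r+b≡a) ⟩
  a + F                                      ≡⟨ cong (a +_) (*-identityʳ F) ⟨
  a + F * 1                                  ≡⟨ cong (λ c → a + F * (if c then 1 else 0)) (dec-true (a <? b) a<b) ⟨
  a + F * (if does (a <? b) then 1 else 0)   ∎
  where
  open ≡-Reasoning
  a<b : a < b
  a<b = +-cancelʳ-< F a b (subst (_< b + F) (trans eq (cong (_+ F) r+b≡a)) (subst (r + b <_) (+-comm F b) (+-monoˡ-< b r<F)))

residue-of-difference≡0⇔ : ∀ {F} .{{_ : NonZero F}} {r a b} → r < F → b < F → (r + b) % F ≡ a → r ≡ 0 ⇔ a ≡ b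
residue-of-difference≡0⇔ {F} {r} {a} {b} r<F b<F r+b≡a = step (a <? b)
  where
  eq = residue-of-difference r<F b<F r+b≡a
  step : Dec (a < b) → r ≡ 0 ⇔ a ≡ b
  step (yes a<b) = mk⇔
    (λ r≡0 → contradiction (subst (_< F) (trans (cong (_+ b) (sym r≡0)) (trans eq (cong (λ c → a + F * (if c then 1 else 0)) (dec-true (a <? b) a<b)))) b<F)
                           (λ lt → <⇒≱ lt (≤-trans (m≤n+m F a) (≤-reflexive (cong (a +_) (sym (*-identityʳ F)))))))
    (λ a≡b → contradiction a≡b (<⇒≢ a<b))
  step (no a≮b) = mk⇔ (λ r≡0 → sym (trans (cong (_+ b) (sym r≡0)) r+b≡a′)) (λ a≡b → +-cancelʳ-≡ b r 0 (trans r+b≡a′ a≡b))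
    where
    r+b≡a′ : r + b ≡ a
    r+b≡a′ = trans eq (trans (cong (λ c → a + F * (if c then 1 else 0)) (dec-false (a <? b) a≮b)) (trans (cong (a +_) (*-zeroʳ F)) (+-identityʳ a)))

-- The factoradic simplex

sumℤ-reverse : ∀ k g → sumℤ {k} (λ c → ℤ.+ g (k ∸ suc (toℕ c))) ≡ ℤ.+ sumBelow g k
sumℤ-reverse zero g = refl
sumℤ-reverse (suc k) g = trans (cong (λ s → ℤ.+ g k ℤ.+ s) (sumℤ-reverse k g)) (sym (ℤP.pos-+ (g k) (sumBelow g k)))

sumℚ-reverse : ∀ k g → sumℚ {k} (λ c → ℕ→ℚ (g (k ∸ suc (toℕ c)))) ≡ ℕ→ℚ (sumBelow g k)
sumℚ-reverse k g = trans (sumℚ-toℚ {k} (λ c → ℤ.+ g (k ∸ suc (toℕ c)))) (cong toℚ (sumℤ-reverse k g))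

module _ (m : ℕ) where

  -- b_{m, m−1−j} for j < m − 1
  weightAt : ℕ → ℕ
  weightAt j = m !/ suc j ∸ m !/ suc (suc j)

  weightAt+ : ∀ {j} → suc j < m → weightAt j + m !/ suc (suc j) ≡ m !/ suc j
  weightAt+ j<m = m∸n+n≡m (!/-suc≤ j<m)

  sumBelow-weightAt : ∀ n → suc n ≡ m → sumBelow weightAt n + 1 ≡ m !
  sumBelow-weightAt n refl = begin
    sumBelow weightAt n + 1                ≡⟨ cong (sumBelow weightAt n +_) (!/-self m) ⟨
    sumBelow weightAt n + m !/ suc n       ≡⟨ telescope weightAt (λ j → m !/ suc j) (λ _ → 0) n (λ j j<n → trans (weightAt+ (s≤s j<n)) (sym (+-identityʳ _))) ⟩
    m !/ 1 + sumBelow (λ _ → 0) n          ≡⟨ cong₂ _+_ (!/-one m) (zeros n) ⟩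
    m ! + 0                                ≡⟨ +-identityʳ (m !) ⟩
    m !                                    ∎
    where
    open ≡-Reasoning
    zeros : ∀ k → sumBelow (λ _ → 0) k ≡ 0
    zeros zero = refl
    zeros (suc k) = zeros k

  residue : ℕ → ℕ → ℕ
  residue t j = (t * weightAt j % m !) {{m !≢0}}

  module _ (t : ℕ) where
    private
      instance _ = m !≢0
      a : ℕ → ℕ
      a j = scaled m t (suc j)

    residue-step : ∀ {j} → suc j < m → (residue t j + a (suc j)) % m ! ≡ a j
    residue-step {j} j<m = begin
      (t * weightAt j % m ! + t * m !/ suc (suc j) % m !) % m !  ≡⟨ %-distribˡ-+ (t * weightAt j) _ (m !) ⟨
      (t * weightAt j + t * m !/ suc (suc j)) % m !               ≡⟨ cong (_% m !) (*-distribˡ-+ t (weightAt j) _) ⟨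
      t * (weightAt j + m !/ suc (suc j)) % m !                   ≡⟨ cong (λ x → t * x % m !) (weightAt+ j<m) ⟩
      t * m !/ suc j % m !                                        ∎
      where open ≡-Reasoning

    residue≡0⇔ : ∀ {j} → suc j < m → residue t j ≡ 0 ⇔ (digit t j ≡ digit t (suc j) × t %! j ≡ 0)
    residue≡0⇔ {j} j<m = scaled-≡⇔ t j j<m ⇔-∘ residue-of-difference≡0⇔ (m%n<n _ (m !)) (scaled< m t (suc (suc j))) (residue-step j<m)

    -- Summing the residues telescopes: each wrap-around modulo m! is an ascent of the factoradic digits.
    residues-telescope : ∀ n → suc n ≡ m → t < m ! → t + sumBelow (residue t) n ≡ m ! * ascents (digit t) n
    residues-telescope n refl t< = begin
      t + sumBelow (residue t) n                            ≡⟨ +-comm t _ ⟩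
      sumBelow (residue t) n + t                            ≡⟨ cong (sumBelow (residue t) n +_) (scaled-self {m} t<) ⟨
      sumBelow (residue t) n + a n                          ≡⟨ telescope (residue t) a wraps n (λ j j<n → residue-of-difference (m%n<n _ (m !)) (scaled< m t (suc (suc j))) (residue-step (s≤s j<n))) ⟩
      a 0 + sumBelow wraps n                                ≡⟨ cong₂ _+_ (scaled-one {m} t (s≤s z≤n)) (sumBelow-*ˡ (m !) _ n) ⟩
      m ! * sumBelow (λ j → if does (ascent? a j) then 1 else 0) n ≡⟨ cong (m ! *_) (count≡sumBelow (ascent? a) n) ⟨
      m ! * ascents a n                                     ≡⟨ cong (m ! *_) (count-cong (ascent? a) (ascent? (digit t)) n (λ j j<n → scaled-<⇔ t j (s≤s j<n))) ⟩
      m ! * ascents (digit t) n                             ∎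
      where
      open ≡-Reasoning
      wraps : ℕ → ℕ
      wraps j = m ! * (if does (a j <? a (suc j)) then 1 else 0)

module FactoradicSimplex (n : ℕ) (q : ℕ → ℕ) (maxDesCounts : IsMaxDesCounts (suc n) q) where
  private
    m = suc n
    instance _ = m !≢0

  weight≡weightAt : ∀ (c : Fin n) → q (suc (toℕ c)) ≡ weightAt m (n ∸ suc (toℕ c))
  weight≡weightAt c = maxDesCount maxDesCounts k (suc (n ∸ suc k)) (s≤s z≤n) (trans (+-suc (suc k) _) (cong suc (m+[n∸m]≡n k<n)))
    where
    k = toℕ c
    k<n = FinP.toℕ<n c

  volume : ℤ.+ (m !) ≡ ℤ.+ 1 ℤ.+ sumℤ (λ (c : Fin n) → ℤ.+ q (suc (toℕ c)))
  volume = sym (begin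
    ℤ.+ 1 ℤ.+ sumℤ {n} (λ c → ℤ.+ q (suc (toℕ c)))                     ≡⟨ cong (λ s → ℤ.+ 1 ℤ.+ s) (sumℤ-cong (λ c → cong ℤ.+_ (weight≡weightAt c))) ⟩
    ℤ.+ 1 ℤ.+ sumℤ {n} (λ c → ℤ.+ weightAt m (n ∸ suc (toℕ c)))        ≡⟨ cong (λ s → ℤ.+ 1 ℤ.+ s) (sumℤ-reverse n (weightAt m)) ⟩
    ℤ.+ 1 ℤ.+ ℤ.+ sumBelow (weightAt m) n                              ≡⟨ ℤP.pos-+ 1 _ ⟨
    ℤ.+ (1 + sumBelow (weightAt m) n)                                   ≡⟨ cong ℤ.+_ (trans (+-comm 1 _) (sumBelow-weightAt m n refl)) ⟩
    ℤ.+ (m !)                                                             ∎)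
    where open ≡-Reasoning

  open OpenParallelepiped n q (m !) volume public

  rem≡residue : ∀ t c → rem t c ≡ residue m t (n ∸ suc (toℕ c))
  rem≡residue t c = cong (λ w → t * w % m !) (weight≡weightAt c)

  rem≢0⇔noRepeatedDigit : ∀ t → (∀ c → rem t c ≢ 0) ⇔ NoRepeatedDigit m t
  rem≢0⇔noRepeatedDigit t = mk⇔
    (λ h i i<m D → to (∀-Fin-reverse⇔ {P = λ j → residue m t j ≢ 0}) (λ c r≡0 → h c (trans (rem≡residue t c) r≡0)) i (≤-pred i<m) (from (residue≡0⇔ m t i<m) D))
    (λ noRepeat c r≡0 → from (∀-Fin-reverse⇔ {P = λ j → residue m t j ≢ 0}) (λ j j<n r≡0 → noRepeat j (s≤s j<n) (to (residue≡0⇔ m t (s≤s j<n)) r≡0)) c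
                          (trans (sym (rem≡residue t c)) r≡0))

  height-point : ∀ {t} → t < m ! → height t ≡ ℤ.+ des (digits m t)
  height-point {t} t< = trans (height≡ t (ascents (digit t) n) (begin
    ℕ→ℚ t ℚ.+ sumℚ (ℕ→ℚ ∘ rem t)                        ≡⟨ cong (ℕ→ℚ t ℚ.+_) (trans (sumℚ-cong (λ c → cong ℕ→ℚ (rem≡residue t c))) (sumℚ-reverse n (residue m t))) ⟩
    ℕ→ℚ t ℚ.+ ℕ→ℚ (sumBelow (residue m t) n)             ≡⟨ ℕ→ℚ-+ t _ ⟨
    ℕ→ℚ (t + sumBelow (residue m t) n)                   ≡⟨ cong ℕ→ℚ (residues-telescope m t n refl t<) ⟩
    ℕ→ℚ (m ! * ascents (digit t) n)                      ≡⟨ ℕ→ℚ-* (m !) _ ⟩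
    ℕ→ℚ (m !) ℚ.* ℕ→ℚ (ascents (digit t) n)              ∎)) (cong ℤ.+_ (sym (des-digits n t)))
    where open ≡-Reasoning

  isInteriorIndex⇔ : 1 ≤ n → ∀ t → IsInteriorIndex t ⇔ (t < m ! × UnitMod6 t)
  isInteriorIndex⇔ 1≤n t = mk⇔
    (λ (_ , t< , rem≢0) → t< , to (noRepeatedDigit⇔unitMod6 (s≤s 1≤n) t<) (to (rem≢0⇔noRepeatedDigit t) rem≢0))
    (λ (t< , u) → unitMod6⇒≥1 {t} u , t< , from (rem≢0⇔noRepeatedDigit t) (from (noRepeatedDigit⇔unitMod6 (s≤s 1≤n) t<) u))

theorem3p3 : (n : ℕ) → 1 ≤ n → (q : ℕ → ℕ) → IsMaxDesCounts (suc n) q →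
    ((k : ℕ) → Σ ℕ (λ c → LocalHStarCoeff (simplex1q n q) k c × RHSCoeff (suc n) k c))
    × (2 ≤ n → LocalHStarAtOne (simplex1q n q) ((suc n) ! / 3))
theorem3p3 n 1≤n q maxDesCounts = (λ k → count (desIs? k) (m !) , lhs k , rhs k) , atOne
  where
  open FactoradicSimplex n q maxDesCounts
  m = suc n
  Δ = simplex1q n q
  desIs? : ∀ k → Decidable (λ t → UnitMod6 t × des (digits m t) ≡ k)
  desIs? k t = unitMod6? t ×-dec (des (digits m t) ≟ k)
  interior⇔ : ∀ x → InOpenPar Δ x ⇔ (Σ ℕ λ t → (t < m ! × UnitMod6 t) × point t ≡ x)
  interior⇔ x = mk⇔ (λ par → forward (to (inOpenPar⇔ x) par)) (λ image → from (inOpenPar⇔ x) (backward image))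
    where
    forward : (Σ ℕ λ t → IsInteriorIndex t × x ≡ point t) → Σ ℕ λ t → (t < m ! × UnitMod6 t) × point t ≡ x
    forward (t , int , x≡) = t , to (isInteriorIndex⇔ 1≤n t) int , sym x≡
    backward : (Σ ℕ λ t → (t < m ! × UnitMod6 t) × point t ≡ x) → Σ ℕ λ t → IsInteriorIndex t × x ≡ point t
    backward (t , tU , ≡x) = t , from (isInteriorIndex⇔ 1≤n t) tU , sym ≡x
  lastPoint : ∀ {t} → t < m ! → Vec.last (point t) ≡ ℤ.+ des (digits m t)
  lastPoint {t} t< = trans (last-∷ʳ (height t) (coordinates t)) (height-point t<)
  lhs : ∀ k → LocalHStarCoeff Δ k (count (desIs? k) (m !))
  lhs k = hasCard-image point (desIs? k) (m !) (λ _ _ → point-injective) λ x → mk⇔ (forward x) (backward x)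
    where
    forward : ∀ x → InOpenPar Δ x × Vec.last x ≡ ℤ.+ k → Σ ℕ λ t → (t < m ! × UnitMod6 t × des (digits m t) ≡ k) × point t ≡ x
    forward x (par , last≡k) = lastDes last≡k (to (interior⇔ x) par)
      where
      lastDes : Vec.last x ≡ ℤ.+ k → (Σ ℕ λ t → (t < m ! × UnitMod6 t) × point t ≡ x) →
        Σ ℕ λ t → (t < m ! × UnitMod6 t × des (digits m t) ≡ k) × point t ≡ x
      lastDes last≡k (t , (t< , u) , ≡x) = t , (t< , u , ℤP.+-injective (trans (sym (lastPoint t<)) (trans (cong Vec.last ≡x) last≡k))) , ≡x
    backward : ∀ x → (Σ ℕ λ t → (t < m ! × UnitMod6 t × des (digits m t) ≡ k) × point t ≡ x) → InOpenPar Δ x × Vec.last x ≡ ℤ.+ k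
    backward x (t , (t< , u , d≡k) , ≡x) = from (interior⇔ x) (t , (t< , u) , ≡x) , trans (cong Vec.last (sym ≡x)) (trans (lastPoint t<) (cong ℤ.+_ d≡k))
  rhs : ∀ k → RHSCoeff m k (count (desIs? k) (m !))
  rhs k = hasCard-image id (desIs? k) (m !) (λ _ _ eq → eq) λ b → mk⇔
    (λ ((_ , b≤) , u , (π , idx , dπ≡k)) → b , (unitMod6-≤! {m} {b} (s≤s 1≤n) b≤ u , u , trans (sym (des-isPermOfIndex idx)) dπ≡k) , refl)
    (λ (t , (t< , u , d≡k) , t≡b) → subst (λ b → (1 ≤ b × b ≤ m !) × UnitMod6 b × ∃[ π ] (IsPermOfIndex m b π × des π ≡ k)) t≡b
      ((unitMod6⇒≥1 {t} u , <⇒≤ t<) , u , permOfIndex m t ,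
       from (isPermOfIndex⇔ n t _) (isPerm-permOfIndex m t , smallerToRight-permOfIndex m t) , trans (des-permOfIndex m t) d≡k))
  atOne : 2 ≤ n → LocalHStarAtOne Δ (m ! / 3)
  atOne 2≤n = subst (HasCard (InOpenPar Δ)) (count-unitMod6-! (s≤s 2≤n))
    (hasCard-image point unitMod6? (m !) (λ _ _ → point-injective) interior⇔)
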